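{- Let $a,b,c,d$ be positive integers. There exist $m\ge2$ and a Kunz nilsemigroup $N=\mathbb Z_m\cup\{\infty\}$ with 3 outer Betti elements and shape $(a,b,c,d)$ if and only if $\gcd(a,b,c,d)=1$.
   Context: Kunz cone $\mathcal C_m\subseteq\mathbb R^{m-1}$ (coordinates indexed by nonzero residues of $\mathbb Z_m$, $x_0=0$): defined by $x_i+x_j\ge x_{i+j}$ for nonzero $i,j$ with $i+j\ne0$. A face with trivial Kunz subgroup (no $x_i$, $i\ne0$, vanishing identically on it) has Kunz nilsemigroup $\mathbb Z_m\cup\{\infty\}$ with nil element $\infty$ and $u\oplus v=u+v$ if $x_u+x_v=x_{u+v}$ on the whole face, $\infty$ otherwise; a Kunz nilsemigroup means one arising this way. Atoms: nonzero elements not a sum of two nonzero elements. For a nilsemigroup with exactly two atoms $p_1,p_2$, factorizations of $n$ are $z\in\mathbb Z^2_{\ge0}$ with $z_1p_1\oplus z_2p_2=n$; $N$ is staircase if every non-nil element has exactly one factorization, and then an outer Betti element is a vector $z$ with $z_1p_1\oplus z_2p_2=\infty$ such that $z-e_i$ is a factorization of a non-nil element for each $i$ with $z_i>0$. A staircase $N$ with two atoms $p_1,p_2$ and exactly three outer Betti elements has shape $(a,b,c,d)\in\mathbb Z_{\ge1}^4$ if (for a suitable ordering of the atoms) its outer Betti elements are $(a,c)$, $(a+b,0)$ and $(0,c+d)$; in this case $m=(a+b)(c+d)-bd$. -}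

module Defs where

open import Data.Nat as ℕ using (ℕ; zero; suc; _>_)
open import Data.Nat.DivMod using (_%_; m%n<n)
open import Data.Fin using (Fin; toℕ; fromℕ<)
open import Data.Integer as ℤ using (ℤ)
open import Data.Maybe using (Maybe; just; nothing)
open import Data.Product using (Σ; _×_; _,_; proj₁; proj₂)
open import Data.Sum using (_⊎_)
open import Data.Unit using (⊤)
open import Data.Bool using (if_then_else_)
open import Relation.Nullary using (¬_; does)
open import Relation.Binary.PropositionalEquality using (_≡_; _≢_)
open import Function.Bundles using (_⇔_)

infixl 6 _+ₘ_
_+ₘ_ : ∀ {m} → Fin m → Fin m → Fin m
_+ₘ_ {suc k} i j = fromℕ< (m%n<n (toℕ i ℕ.+ toℕ j) (suc k))

-- The residue 0 of ℤ_m (m is nonzero since Fin m is inhabited).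
zeroOf : ∀ {m} → Fin m → Fin m
zeroOf {suc k} _ = Fin.zero

-- A point of the Kunz cone C_m with integer coordinates, lying in the
-- relative interior of a face with trivial Kunz subgroup.  Coordinates are
-- indexed by all residues, with the convention x_0 = 0.
record KunzPoint (m : ℕ) : Set where
  field
    x            : Fin m → ℤ
    x-zero       : ∀ i → toℕ i ≡ 0 → x i ≡ ℤ.0ℤ
    cone         : ∀ i j → toℕ i ≢ 0 → toℕ j ≢ 0 → toℕ (i +ₘ j) ≢ 0 →
                   x (i +ₘ j) ℤ.≤ x i ℤ.+ x j
    trivialGroup : ∀ i → toℕ i ≢ 0 → x i ≢ ℤ.0ℤ

-- The Kunz nilsemigroup N = ℤ_m ∪ {∞} of the face whose relative interior
-- contains the given point; `nothing` is the nil element ∞.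
module Nil {m : ℕ} (K : KunzPoint m) where
  open KunzPoint K

  Elem : Set
  Elem = Maybe (Fin m)

  infixl 6 _⊕_
  _⊕_ : Elem → Elem → Elem
  just u  ⊕ just v  = if does (x u ℤ.+ x v ℤ.≟ x (u +ₘ v)) then just (u +ₘ v) else nothing
  just _  ⊕ nothing = nothing
  nothing ⊕ _       = nothing

  -- "nonzero": different from the identity 0 (∞ counts as nonzero)
  NonZeroE : Elem → Set
  NonZeroE nothing  = ⊤
  NonZeroE (just i) = toℕ i ≢ 0

  Atom : Elem → Set
  Atom u = NonZeroE u × (∀ v w → NonZeroE v → NonZeroE w → v ⊕ w ≢ u)

  _·_ : ℕ → Fin m → Elem
  zero  · p = just (zeroOf p)
  suc k · p = just p ⊕ (k · p)

  eval : Fin m → Fin m → ℕ × ℕ → Elem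
  eval p₁ p₂ (z₁ , z₂) = (z₁ · p₁) ⊕ (z₂ · p₂)

  Staircase : Fin m → Fin m → Set
  Staircase p₁ p₂ = ∀ (n : Fin m) →
    Σ (ℕ × ℕ) (λ z → eval p₁ p₂ z ≡ just n) ×
    (∀ z z′ → eval p₁ p₂ z ≡ just n → eval p₁ p₂ z′ ≡ just n → z ≡ z′)

  OuterBetti : Fin m → Fin m → ℕ × ℕ → Set
  OuterBetti p₁ p₂ (z₁ , z₂) =
    eval p₁ p₂ (z₁ , z₂) ≡ nothing ×
    (z₁ > 0 → Σ (Fin m) λ n → eval p₁ p₂ (ℕ.pred z₁ , z₂) ≡ just n) ×
    (z₂ > 0 → Σ (Fin m) λ n → eval p₁ p₂ (z₁ , ℕ.pred z₂) ≡ just n)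

  HasShape : ℕ → ℕ → ℕ → ℕ → Set
  HasShape a b c d = Σ (Fin m) λ p₁ → Σ (Fin m) λ p₂ →
    p₁ ≢ p₂ × Atom (just p₁) × Atom (just p₂) ×
    (∀ u → Atom u → u ≡ just p₁ ⊎ u ≡ just p₂) ×
    Staircase p₁ p₂ ×
    (∀ z → OuterBetti p₁ p₂ z ⇔
       (z ≡ (a , c) ⊎ z ≡ (a ℕ.+ b , 0) ⊎ z ≡ (0 , c ℕ.+ d)))

module Submission where

-- Let L ⊂ ℕ² be the staircase {z | z₁ < a + b , z₂ < c} ∪ {z | z₁ < a , z₂ < c + d}, whose outer corners are
-- (a , c), (a + b , 0) and (0 , c + d). A Kunz nilsemigroup of shape (a , b , c , d) on ℤ_m amounts to a pair of
-- atoms P = (p₁ , p₂) for which z ↦ z ∙ P = z₁ p₁ + z₂ p₂ maps L bijectively onto ℤ_m. Given the nilsemigroup, the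
-- factorizations of its non-nil elements form a down-closed set with the same outer corners as L, hence equal L.
-- Given the bijection, weighting each residue by z₁ (c + d) + z₂ (a + b) for its preimage z ∈ L is a point of the
-- Kunz cone, and its nilsemigroup is L under addition inside L.
--
-- Such a bijection forces the relations a p₁ + c p₂ = 0 and (a + b) p₁ = d p₂, and every vector of ℕ² rewrites into
-- L along them; so ℤ² modulo the lattice Λ of relations is the cyclic group ℤ_m. As Λ ⊆ g ℤ² for
-- g = gcd (a , b , c , d), the group (ℤ / g)² is then cyclic too, which forces g = 1. Conversely, when g = 1 a
-- Smith normal form computation produces P = (c + d - c σ , b + a σ) whose kernel is exactly Λ, and L is a
-- fundamental domain of Λ.

open import Defs
open import Data.Nat using (ℕ; zero; suc; _≤_; _>_)
open import Data.Nat.GCD using (gcd)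
open import Data.Fin using (Fin; toℕ)
open import Data.Product using (Σ; _×_; _,_)
open import Relation.Binary.PropositionalEquality using (_≡_; _≢_)
open import Function.Bundles using (_⇔_; mk⇔)

module Congruence where

  open import Data.Nat using (ℕ; zero; suc; _+_; _*_; _∸_; _<_; NonZero)
  open import Data.Nat.Properties using (+-comm; +-assoc; +-identityʳ; m+[n∸m]≡n; *-identityˡ)
  open import Data.Nat.DivMod
  open import Data.Nat.Divisibility using (_∣_; divides)
  open import Data.Fin using (Fin; toℕ)
  open import Data.Fin.Properties using (toℕ-fromℕ<; toℕ-injective; toℕ<n)
  open import Relation.Binary.PropositionalEquality
  open import Relation.Binary.Bundles using (Setoid)

  infix 4 _≡_[mod_]
  record _≡_[mod_] (x y n : ℕ) .{{_ : NonZero n}} : Set where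
    constructor mod-by
    field %-≡ : x % n ≡ y % n

  module _ {n : ℕ} .{{_ : NonZero n}} where

    mod-reflexive : ∀ {x y} → x ≡ y → x ≡ y [mod n ]
    mod-reflexive refl = mod-by refl

    mod-refl : ∀ {x} → x ≡ x [mod n ]
    mod-refl = mod-by refl

    mod-sym : ∀ {x y} → x ≡ y [mod n ] → y ≡ x [mod n ]
    mod-sym (mod-by e) = mod-by (sym e)

    mod-trans : ∀ {x y z} → x ≡ y [mod n ] → y ≡ z [mod n ] → x ≡ z [mod n ]
    mod-trans (mod-by e) (mod-by f) = mod-by (trans e f)

    mod-setoid : Setoid _ _
    mod-setoid = record
      { Carrier = ℕ
      ; _≈_ = _≡_[mod n ]
      ; isEquivalence = record { refl = mod-refl ; sym = mod-sym ; trans = mod-trans }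
      }

    +-cong-mod : ∀ {x x′ y y′} → x ≡ x′ [mod n ] → y ≡ y′ [mod n ] → x + y ≡ x′ + y′ [mod n ]
    +-cong-mod {x} {x′} {y} {y′} (mod-by e) (mod-by f) = mod-by (begin
      (x + y) % n              ≡⟨ %-distribˡ-+ x y n ⟩
      (x % n + y % n) % n      ≡⟨ cong₂ (λ u v → (u + v) % n) e f ⟩
      (x′ % n + y′ % n) % n    ≡⟨ %-distribˡ-+ x′ y′ n ⟨
      (x′ + y′) % n            ∎)
      where open ≡-Reasoning

    *-cong-mod : ∀ {x x′ y y′} → x ≡ x′ [mod n ] → y ≡ y′ [mod n ] → x * y ≡ x′ * y′ [mod n ]
    *-cong-mod {x} {x′} {y} {y′} (mod-by e) (mod-by f) = mod-by (begin
      (x * y) % n              ≡⟨ %-distribˡ-* x y n ⟩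
      (x % n * (y % n)) % n    ≡⟨ cong₂ (λ u v → (u * v) % n) e f ⟩
      (x′ % n * (y′ % n)) % n  ≡⟨ %-distribˡ-* x′ y′ n ⟨
      (x′ * y′) % n            ∎)
      where open ≡-Reasoning

    %-mod : ∀ x → x % n ≡ x [mod n ]
    %-mod x = mod-by (m%n%n≡m%n x n)

    +-*-mod : ∀ x q → x + q * n ≡ x [mod n ]
    +-*-mod x q = mod-by ([m+kn]%n≡m%n x q n)

    ∣⇒≡0-mod : ∀ {x} → n ∣ x → x ≡ 0 [mod n ]
    ∣⇒≡0-mod (divides q refl) = +-*-mod 0 q

    +-cancelʳ-mod : ∀ {x y} z → x + z ≡ y + z [mod n ] → x ≡ y [mod n ]
    +-cancelʳ-mod {x} {y} z e = mod-trans (mod-sym (shift x)) (mod-trans (+-cong-mod e′ mod-refl) (shift y))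
      where
      r = z % n
      shift : ∀ w → w + r + (n ∸ r) ≡ w [mod n ]
      shift w = mod-trans (mod-reflexive (begin
          w + r + (n ∸ r)    ≡⟨ +-assoc w r (n ∸ r) ⟩
          w + (r + (n ∸ r))  ≡⟨ cong (w +_) (m+[n∸m]≡n (m%n≤n z n)) ⟩
          w + n              ≡⟨ cong (w +_) (*-identityˡ n) ⟨
          w + 1 * n          ∎)) (+-*-mod w 1)
        where open ≡-Reasoning
      e′ : x + r ≡ y + r [mod n ]
      e′ = mod-trans (+-cong-mod mod-refl (%-mod z)) (mod-trans e (+-cong-mod mod-refl (mod-sym (%-mod z))))

    <-mod-injective : ∀ {x y} → x < n → y < n → x ≡ y [mod n ] → x ≡ y
    <-mod-injective x<n y<n (mod-by e) = trans (sym (m<n⇒m%n≡m x<n)) (trans e (m<n⇒m%n≡m y<n))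

    toℕ-mod : ∀ x → toℕ (x mod n) ≡ x [mod n ]
    toℕ-mod x = mod-trans (mod-reflexive (toℕ-fromℕ< (m%n<n x n))) (%-mod x)

    toℕ-mod-injective : ∀ {i j : Fin n} → toℕ i ≡ toℕ j [mod n ] → i ≡ j
    toℕ-mod-injective {i} {j} e = toℕ-injective (<-mod-injective (toℕ<n i) (toℕ<n j) e)

  1≡0-mod⇒≡1 : ∀ {n} .{{_ : NonZero n}} → 1 ≡ 0 [mod n ] → n ≡ 1
  1≡0-mod⇒≡1 {suc zero} _ = refl
  1≡0-mod⇒≡1 {suc (suc n)} (mod-by ())

  module ≡-mod-Reasoning (n : ℕ) .{{_ : NonZero n}} where
    open import Relation.Binary.Reasoning.Setoid (mod-setoid {n}) public

  module _ {k : ℕ} where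

    toℕ-+ₘ : ∀ (i j : Fin (suc k)) → toℕ (i +ₘ j) ≡ toℕ i + toℕ j [mod suc k ]
    toℕ-+ₘ i j = toℕ-mod (toℕ i + toℕ j)

    +ₘ-comm : ∀ (i j : Fin (suc k)) → i +ₘ j ≡ j +ₘ i
    +ₘ-comm i j = cong (_mod suc k) (+-comm (toℕ i) (toℕ j))

    +ₘ-assoc : ∀ (i j l : Fin (suc k)) → (i +ₘ j) +ₘ l ≡ i +ₘ (j +ₘ l)
    +ₘ-assoc i j l = toℕ-mod-injective (begin
      toℕ ((i +ₘ j) +ₘ l)          ≈⟨ toℕ-+ₘ (i +ₘ j) l ⟩
      toℕ (i +ₘ j) + toℕ l         ≈⟨ +-cong-mod (toℕ-+ₘ i j) mod-refl ⟩
      toℕ i + toℕ j + toℕ l        ≡⟨ +-assoc (toℕ i) (toℕ j) (toℕ l) ⟩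
      toℕ i + (toℕ j + toℕ l)      ≈⟨ +-cong-mod mod-refl (toℕ-+ₘ j l) ⟨
      toℕ i + toℕ (j +ₘ l)         ≈⟨ toℕ-+ₘ i (j +ₘ l) ⟨
      toℕ (i +ₘ (j +ₘ l))          ∎)
      where open ≡-mod-Reasoning (suc k)

    +ₘ-identityʳ : ∀ (i : Fin (suc k)) → i +ₘ Fin.zero ≡ i
    +ₘ-identityʳ i = toℕ-mod-injective (mod-trans (toℕ-+ₘ i Fin.zero) (mod-reflexive (+-identityʳ (toℕ i))))

    +ₘ-identityˡ : ∀ (i : Fin (suc k)) → Fin.zero +ₘ i ≡ i
    +ₘ-identityˡ i = trans (+ₘ-comm Fin.zero i) (+ₘ-identityʳ i)

open Congruence

module Staircases where

  open import Data.Nat using (ℕ; zero; suc; _+_; _*_; _<_; _≤_; _>_; z≤n; s≤s; _≤?_; _<?_; pred; NonZero; ≢-nonZero)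
  open import Data.Nat.Properties
  open import Data.Nat.Divisibility using (_∣_; ∣m∣n⇒∣m+n; ∣-trans)
  open import Data.Nat.GCD using (gcd; gcd[m,n]∣m; gcd[m,n]∣n; gcd[m,n]≢0)
  open import Data.Nat.DivMod using (n%1≡0)
  open import Data.Nat.Induction using (<-wellFounded)
  open import Data.Nat.Tactic.RingSolver using (solve)
  open import Data.List using ([]; _∷_)
  open import Data.Product using (Σ; ∃; _×_; _,_; proj₁; proj₂)
  open import Data.Sum using (_⊎_; inj₁; inj₂)
  open import Function.Bundles using (_⇔_; mk⇔)
  open import Induction.WellFounded using (Acc; acc)
  open import Relation.Nullary using (¬_; Dec; yes; no; contradiction)
  open import Relation.Nullary.Decidable using (_×-dec_; _⊎-dec_)
  open import Relation.Binary.PropositionalEquality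
  open import Relation.Binary.Construct.Closure.ReflexiveTransitive using (Star; ε; _◅_)

  infixl 6 _⊞_
  _⊞_ : ℕ × ℕ → ℕ × ℕ → ℕ × ℕ
  (y₁ , y₂) ⊞ (z₁ , z₂) = (y₁ + z₁ , y₂ + z₂)

  infix 7 _∙_
  _∙_ : ℕ × ℕ → ℕ × ℕ → ℕ
  (z₁ , z₂) ∙ (P₁ , P₂) = z₁ * P₁ + z₂ * P₂

  ∙-distribʳ-⊞ : ∀ y z P → (y ⊞ z) ∙ P ≡ y ∙ P + z ∙ P
  ∙-distribʳ-⊞ (y₁ , y₂) (z₁ , z₂) (P₁ , P₂) = begin
    (y₁ + z₁) * P₁ + (y₂ + z₂) * P₂            ≡⟨ solve (y₁ ∷ y₂ ∷ z₁ ∷ z₂ ∷ P₁ ∷ P₂ ∷ []) ⟩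
    (y₁ * P₁ + y₂ * P₂) + (z₁ * P₁ + z₂ * P₂)  ∎
    where open ≡-Reasoning

  ∙-scale : ∀ n u₁ u₂ P₁ P₂ → (n * u₁ , n * u₂) ∙ (P₁ , P₂) ≡ n * ((u₁ , u₂) ∙ (P₁ , P₂))
  ∙-scale n u₁ u₂ P₁ P₂ = begin
    n * u₁ * P₁ + n * u₂ * P₂     ≡⟨ solve (n ∷ u₁ ∷ u₂ ∷ P₁ ∷ P₂ ∷ []) ⟩
    n * (u₁ * P₁ + u₂ * P₂)       ∎
    where open ≡-Reasoning

  module Shape (a b c d : ℕ) (a>0 : a > 0) (b>0 : b > 0) (c>0 : c > 0) (d>0 : d > 0) where

    a+b>0 : a + b > 0
    a+b>0 = ≤-trans a>0 (m≤m+n a b)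

    c+d>0 : c + d > 0
    c+d>0 = ≤-trans c>0 (m≤m+n c d)

    L : ℕ × ℕ → Set
    L (z₁ , z₂) = (z₁ < a + b × z₂ < c) ⊎ (z₁ < a × z₂ < c + d)

    L? : ∀ z → Dec (L z)
    L? (z₁ , z₂) = (z₁ <? a + b ×-dec z₂ <? c) ⊎-dec (z₁ <? a ×-dec z₂ <? c + d)

    L-⊞ˡ : ∀ y z → L (y ⊞ z) → L y
    L-⊞ˡ (y₁ , y₂) (z₁ , z₂) (inj₁ (p , q)) = inj₁ (≤-<-trans (m≤m+n y₁ z₁) p , ≤-<-trans (m≤m+n y₂ z₂) q)
    L-⊞ˡ (y₁ , y₂) (z₁ , z₂) (inj₂ (p , q)) = inj₂ (≤-<-trans (m≤m+n y₁ z₁) p , ≤-<-trans (m≤m+n y₂ z₂) q)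

    L-⊞ʳ : ∀ y z → L (y ⊞ z) → L z
    L-⊞ʳ (y₁ , y₂) (z₁ , z₂) (inj₁ (p , q)) = inj₁ (≤-<-trans (m≤n+m z₁ y₁) p , ≤-<-trans (m≤n+m z₂ y₂) q)
    L-⊞ʳ (y₁ , y₂) (z₁ , z₂) (inj₂ (p , q)) = inj₂ (≤-<-trans (m≤n+m z₁ y₁) p , ≤-<-trans (m≤n+m z₂ y₂) q)

    L-pred₁ : ∀ {i j} → L (suc i , j) → L (i , j)
    L-pred₁ (inj₁ (p , q)) = inj₁ (<⇒≤ p , q)
    L-pred₁ (inj₂ (p , q)) = inj₂ (<⇒≤ p , q)

    L-pred₂ : ∀ {i j} → L (i , suc j) → L (i , j)
    L-pred₂ (inj₁ (p , q)) = inj₁ (p , <⇒≤ q)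
    L-pred₂ (inj₂ (p , q)) = inj₂ (p , <⇒≤ q)

    L⇒<a+b : ∀ {z₁ z₂} → L (z₁ , z₂) → z₁ < a + b
    L⇒<a+b (inj₁ (p , _)) = p
    L⇒<a+b (inj₂ (p , _)) = <-≤-trans p (m≤m+n a b)

    L⇒<c+d : ∀ {z₁ z₂} → L (z₁ , z₂) → z₂ < c + d
    L⇒<c+d (inj₁ (_ , q)) = <-≤-trans q (m≤m+n c d)
    L⇒<c+d (inj₂ (_ , q)) = q

    0∈L : L (0 , 0)
    0∈L = inj₁ (a+b>0 , c>0)

    e₁∈L : L (1 , 0)
    e₁∈L = inj₁ (+-mono-≤ a>0 b>0 , c>0)

    e₂∈L : L (0 , 1)
    e₂∈L = inj₂ (a>0 , +-mono-≤ c>0 d>0)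

    Corner : ℕ × ℕ → Set
    Corner z = z ≡ (a , c) ⊎ z ≡ (a + b , 0) ⊎ z ≡ (0 , c + d)

    corner∉L : ∀ {z} → Corner z → ¬ L z
    corner∉L (inj₁ refl)        (inj₁ (_ , c<c))     = n≮n c c<c
    corner∉L (inj₁ refl)        (inj₂ (a<a , _))     = n≮n a a<a
    corner∉L (inj₂ (inj₁ refl)) (inj₁ (ab<ab , _))   = n≮n (a + b) ab<ab
    corner∉L (inj₂ (inj₁ refl)) (inj₂ (ab<a , _))    = n≮n a (≤-<-trans (m≤m+n a b) ab<a)
    corner∉L (inj₂ (inj₂ refl)) (inj₁ (_ , cd<c))    = n≮n c (≤-<-trans (m≤m+n c d) cd<c)
    corner∉L (inj₂ (inj₂ refl)) (inj₂ (_ , cd<cd))   = n≮n (c + d) cd<cd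

    -- The outer Betti relations, oriented as rewriting rules on exponent vectors.
    data Rule : ℕ × ℕ → ℕ × ℕ → Set where
      ac⇒0  : Rule (a , c) (0 , 0)
      ab⇒d  : Rule (a + b , 0) (0 , d)
      cd⇒b  : Rule (0 , c + d) (b , 0)

    infix 4 _⟶_
    data _⟶_ : ℕ × ℕ → ℕ × ℕ → Set where
      step : ∀ {w w′} → Rule w w′ → ∀ δ → w ⊞ δ ⟶ w′ ⊞ δ

    infix 4 _⟶*_
    _⟶*_ : ℕ × ℕ → ℕ × ℕ → Set
    _⟶*_ = Star _⟶_

    rule-corner : ∀ {w w′} → Rule w w′ → Corner w
    rule-corner ac⇒0 = inj₁ refl
    rule-corner ab⇒d = inj₂ (inj₁ refl)
    rule-corner cd⇒b = inj₂ (inj₂ refl)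

    L-or-⟶ : ∀ z → L z ⊎ ∃ (z ⟶_)
    L-or-⟶ (z₁ , z₂) with a ≤? z₁ | c ≤? z₂
    ... | yes a≤z₁ | yes c≤z₂ with m≤n⇒∃[o]m+o≡n a≤z₁ | m≤n⇒∃[o]m+o≡n c≤z₂
    ...   | i , refl | j , refl = inj₂ (_ , step ac⇒0 (i , j))
    L-or-⟶ (z₁ , z₂) | yes a≤z₁ | no c≰z₂ with a + b ≤? z₁
    ...   | yes ab≤z₁ with m≤n⇒∃[o]m+o≡n ab≤z₁
    ...     | i , refl = inj₂ (_ , step ab⇒d (i , z₂))
    L-or-⟶ (z₁ , z₂) | yes a≤z₁ | no c≰z₂ | no ab≰z₁ = inj₁ (inj₁ (≰⇒> ab≰z₁ , ≰⇒> c≰z₂))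
    L-or-⟶ (z₁ , z₂) | no a≰z₁ | _ with c + d ≤? z₂
    ...   | yes cd≤z₂ with m≤n⇒∃[o]m+o≡n cd≤z₂
    ...     | j , refl = inj₂ (_ , step cd⇒b (z₁ , j))
    L-or-⟶ (z₁ , z₂) | no a≰z₁ | _ | no cd≰z₂ = inj₁ (inj₂ (≰⇒> a≰z₁ , ≰⇒> cd≰z₂))

    ∉L⇒above-corner : ∀ {z} → ¬ L z → Σ (ℕ × ℕ) λ w → Σ (ℕ × ℕ) λ δ → Corner w × z ≡ w ⊞ δ
    ∉L⇒above-corner {z} z∉L with L-or-⟶ z
    ... | inj₁ zL = contradiction zL z∉L
    ... | inj₂ (_ , step r δ) = _ , δ , rule-corner r , refl

    W : ℕ × ℕ → ℕ
    W z = z ∙ (c + d , a + b)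

    W-rule : ∀ {w w′} → Rule w w′ → W w′ < W w
    W-rule ac⇒0 = ≤-trans (*-mono-≤ a>0 c+d>0) (m≤m+n (a * (c + d)) (c * (a + b)))
    W-rule ab⇒d = subst (d * (a + b) <_) (begin
      d * (a + b) + (a + b) * c      ≡⟨ solve (a ∷ b ∷ c ∷ d ∷ []) ⟩
      (a + b) * (c + d) + 0          ∎) (m<m+n (d * (a + b)) (*-mono-≤ a+b>0 c>0))
      where open ≡-Reasoning
    W-rule cd⇒b = subst₂ _<_ (sym (+-identityʳ (b * (c + d)))) (begin
      b * (c + d) + (c + d) * a      ≡⟨ solve (a ∷ b ∷ c ∷ d ∷ []) ⟩
      (c + d) * (a + b)              ∎) (m<m+n (b * (c + d)) (*-mono-≤ c+d>0 a>0))
      where open ≡-Reasoning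

    W-⊞ : ∀ y z → W (y ⊞ z) ≡ W y + W z
    W-⊞ y z = ∙-distribʳ-⊞ y z (c + d , a + b)

    W≡0 : ∀ {z} → W z ≡ 0 → z ≡ (0 , 0)
    W≡0 {zero , zero} _ = refl
    W≡0 {suc i , j} e = contradiction (m+n≡0⇒m≡0 (c + d) (m+n≡0⇒m≡0 (suc i * (c + d)) e)) (≢-sym (<⇒≢ c+d>0))
    W≡0 {zero , suc j} e = contradiction (m+n≡0⇒m≡0 (a + b) e) (≢-sym (<⇒≢ a+b>0))

    W-⟶ : ∀ {z y} → z ⟶ y → W y < W z
    W-⟶ (step {w} {w′} r δ) = subst₂ _<_ (sym (W-⊞ w′ δ)) (sym (W-⊞ w δ)) (+-monoˡ-< (W δ) (W-rule r))

    W-⟶* : ∀ {z y} → z ⟶* y → W y ≤ W z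
    W-⟶* ε = ≤-refl
    W-⟶* (s ◅ ss) = ≤-trans (W-⟶* ss) (<⇒≤ (W-⟶ s))

    W-⟶*-strict : ∀ {z y} → z ⟶* y → y ≢ z → W y < W z
    W-⟶*-strict ε y≢z = contradiction refl y≢z
    W-⟶*-strict (s ◅ ss) _ = ≤-<-trans (W-⟶* ss) (W-⟶ s)

    reduce : ∀ z → Σ (ℕ × ℕ) λ y → z ⟶* y × L y
    reduce z = go z (<-wellFounded (W z))
      where
      go : ∀ z → Acc _<_ (W z) → Σ (ℕ × ℕ) λ y → z ⟶* y × L y
      go z (acc rec) with L-or-⟶ z
      ... | inj₁ zL = z , ε , zL
      ... | inj₂ (y , z⟶y) with go y (rec (W-⟶ z⟶y))
      ...   | w , y⟶*w , wL = w , z⟶y ◅ y⟶*w , wL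

    OuterCorner : ℕ × ℕ → Set
    OuterCorner (z₁ , z₂) = ¬ L (z₁ , z₂) × (z₁ > 0 → L (pred z₁ , z₂)) × (z₂ > 0 → L (z₁ , pred z₂))

    private
      pred< : ∀ {n} → n > 0 → pred n < n
      pred< {suc n} _ = n<1+n n

    corner⇒outer : ∀ {z} → Corner z → OuterCorner z
    corner⇒outer κ@(inj₁ refl) =
      corner∉L κ , (λ _ → inj₂ (pred< a>0 , m<m+n c d>0)) , (λ _ → inj₁ (m<m+n a b>0 , pred< c>0))
    corner⇒outer κ@(inj₂ (inj₁ refl)) = corner∉L κ , (λ _ → inj₁ (pred< a+b>0 , c>0)) , λ ()
    corner⇒outer κ@(inj₂ (inj₂ refl)) = corner∉L κ , (λ ()) , (λ _ → inj₂ (a>0 , pred< c+d>0))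

    private
      pred-of-suc₁ : ∀ {x i y} → (x + suc i > 0 → L (pred (x + suc i) , y)) → L (x + i , y)
      pred-of-suc₁ {x} {i} h rewrite +-suc x i = h (s≤s z≤n)

      pred-of-suc₂ : ∀ {x y j} → (y + suc j > 0 → L (x , pred (y + suc j))) → L (x , y + j)
      pred-of-suc₂ {y = y} {j} h rewrite +-suc y j = h (s≤s z≤n)

    -- An outer corner lies above some corner w; any surplus would leave a predecessor above w, outside L.
    outer⇒corner : ∀ {z} → OuterCorner z → Corner z
    outer⇒corner (z∉L , pred₁∈L , pred₂∈L) with ∉L⇒above-corner z∉L
    ... | (w₁ , w₂) , (zero , zero) , κ , refl = subst Corner (sym (cong₂ _,_ (+-identityʳ w₁) (+-identityʳ w₂))) κ
    ... | w , (suc i , j) , κ , refl = contradiction (L-⊞ˡ w (i , j) (pred-of-suc₁ pred₁∈L)) (corner∉L κ)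
    ... | w , (zero , suc j) , κ , refl = contradiction (L-⊞ˡ w (0 , j) (pred-of-suc₂ pred₂∈L)) (corner∉L κ)

    outer⇔corner : ∀ z → OuterCorner z ⇔ Corner z
    outer⇔corner z = mk⇔ outer⇒corner corner⇒outer

    module _ {n : ℕ} .{{_ : NonZero n}} (P₁ P₂ : ℕ)
             (R₁ : (a , c) ∙ (P₁ , P₂) ≡ 0 [mod n ])
             (R₂ : (a + b , 0) ∙ (P₁ , P₂) ≡ (0 , d) ∙ (P₁ , P₂) [mod n ]) where

      R₃ : (0 , c + d) ∙ (P₁ , P₂) ≡ (b , 0) ∙ (P₁ , P₂) [mod n ]
      R₃ = +-cancelʳ-mod (a * P₁) (begin
        (c + d) * P₂ + a * P₁          ≡⟨ solve (a ∷ c ∷ d ∷ P₁ ∷ P₂ ∷ []) ⟩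
        (a * P₁ + c * P₂) + d * P₂     ≈⟨ +-cong-mod R₁ mod-refl ⟩
        d * P₂                         ≈⟨ R₂ ⟨
        (a + b) * P₁ + 0               ≡⟨ solve (a ∷ b ∷ P₁ ∷ []) ⟩
        b * P₁ + 0 + a * P₁            ∎)
        where open ≡-mod-Reasoning n

      rule-∙ : ∀ {w w′} → Rule w w′ → w ∙ (P₁ , P₂) ≡ w′ ∙ (P₁ , P₂) [mod n ]
      rule-∙ ac⇒0 = R₁
      rule-∙ ab⇒d = R₂
      rule-∙ cd⇒b = R₃

      ⟶*-∙ : ∀ {z y} → z ⟶* y → z ∙ (P₁ , P₂) ≡ y ∙ (P₁ , P₂) [mod n ]
      ⟶*-∙ ε = mod-refl
      ⟶*-∙ (step {w} {w′} r δ ◅ ss) = mod-trans (begin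
        (w ⊞ δ) ∙ P                    ≡⟨ ∙-distribʳ-⊞ w δ P ⟩
        w ∙ P + δ ∙ P                  ≈⟨ +-cong-mod (rule-∙ r) mod-refl ⟩
        w′ ∙ P + δ ∙ P                 ≡⟨ ∙-distribʳ-⊞ w′ δ P ⟨
        (w′ ⊞ δ) ∙ P                   ∎) (⟶*-∙ ss)
        where
        P = (P₁ , P₂)
        open ≡-mod-Reasoning n

      ∙-surjective-from : ∀ u₁ u₂ → (u₁ , u₂) ∙ (P₁ , P₂) ≡ 1 [mod n ] →
                          ∀ N → Σ (ℕ × ℕ) λ y → L y × y ∙ (P₁ , P₂) ≡ N [mod n ]
      ∙-surjective-from u₁ u₂ u≈1 N with reduce (N * u₁ , N * u₂)
      ... | y , Nu⟶*y , y∈L = y , y∈L , (begin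
        y ∙ (P₁ , P₂)                       ≈⟨ ⟶*-∙ Nu⟶*y ⟨
        (N * u₁ , N * u₂) ∙ (P₁ , P₂)       ≡⟨ ∙-scale N u₁ u₂ P₁ P₂ ⟩
        N * ((u₁ , u₂) ∙ (P₁ , P₂))         ≈⟨ *-cong-mod (mod-refl {x = N}) u≈1 ⟩
        N * 1                               ≡⟨ *-identityʳ N ⟩
        N                                   ∎)
        where open ≡-mod-Reasoning n

    module _ {g : ℕ} .{{_ : NonZero g}} (g∣a : g ∣ a) (g∣b : g ∣ b) (g∣c : g ∣ c) (g∣d : g ∣ d) where

      rule-mod : ∀ {w w′} → Rule w w′ → proj₁ w ≡ proj₁ w′ [mod g ] × proj₂ w ≡ proj₂ w′ [mod g ]
      rule-mod ac⇒0 = ∣⇒≡0-mod g∣a , ∣⇒≡0-mod g∣c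
      rule-mod ab⇒d = ∣⇒≡0-mod (∣m∣n⇒∣m+n g∣a g∣b) , mod-sym (∣⇒≡0-mod g∣d)
      rule-mod cd⇒b = mod-sym (∣⇒≡0-mod g∣b) , ∣⇒≡0-mod (∣m∣n⇒∣m+n g∣c g∣d)

      ⟶*-mod : ∀ {z y} → z ⟶* y → proj₁ z ≡ proj₁ y [mod g ] × proj₂ z ≡ proj₂ y [mod g ]
      ⟶*-mod ε = mod-refl , mod-refl
      ⟶*-mod (step r δ ◅ ss) with rule-mod r | ⟶*-mod ss
      ... | r₁ , r₂ | s₁ , s₂ = mod-trans (+-cong-mod r₁ mod-refl) s₁ , mod-trans (+-cong-mod r₂ mod-refl) s₂

    record Bijective (m : ℕ) .{{_ : NonZero m}} (P₁ P₂ : ℕ) : Set where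
      field
        ∙-injective  : ∀ {y y′} → L y → L y′ → y ∙ (P₁ , P₂) ≡ y′ ∙ (P₁ , P₂) [mod m ] → y ≡ y′
        ∙-surjective : ∀ N → Σ (ℕ × ℕ) λ y → L y × y ∙ (P₁ , P₂) ≡ N [mod m ]

      private
        P : ℕ × ℕ
        P = (P₁ , P₂)

      ∙-suc₁ : ∀ i j → (suc i , j) ∙ P ≡ (i , j) ∙ P + P₁
      ∙-suc₁ i j = begin
        P₁ + i * P₁ + j * P₂     ≡⟨ solve (i ∷ j ∷ P₁ ∷ P₂ ∷ []) ⟩
        i * P₁ + j * P₂ + P₁     ∎
        where open ≡-Reasoning

      ∙-suc₂ : ∀ i j → (i , suc j) ∙ P ≡ (i , j) ∙ P + P₂
      ∙-suc₂ i j = begin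
        i * P₁ + (P₂ + j * P₂)   ≡⟨ solve (i ∷ j ∷ P₁ ∷ P₂ ∷ []) ⟩
        i * P₁ + j * P₂ + P₂     ∎
        where open ≡-Reasoning

      shared-support₁ : ∀ {i j w₁ w₂} → L (suc i , j) → L (w₁ , w₂) →
                        (suc i , j) ∙ P ≡ (suc w₁ , w₂) ∙ P [mod m ] → L (suc w₁ , w₂)
      shared-support₁ {i} {j} {w₁} {w₂} yL wL e
        with refl ← ∙-injective (L-pred₁ yL) wL (+-cancelʳ-mod P₁
                      (mod-trans (mod-reflexive (sym (∙-suc₁ i j))) (mod-trans e (mod-reflexive (∙-suc₁ w₁ w₂))))) = yL

      shared-support₂ : ∀ {i j w₁ w₂} → L (i , suc j) → L (w₁ , w₂) →
                        (i , suc j) ∙ P ≡ (w₁ , suc w₂) ∙ P [mod m ] → L (w₁ , suc w₂)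
      shared-support₂ {i} {j} {w₁} {w₂} yL wL e
        with refl ← ∙-injective (L-pred₂ yL) wL (+-cancelʳ-mod P₂
                      (mod-trans (mod-reflexive (sym (∙-suc₂ i j))) (mod-trans e (mod-reflexive (∙-suc₂ w₁ w₂))))) = yL

      corner-support₁ : ∀ {y w} → L y → Corner w → y ∙ P ≡ w ∙ P [mod m ] → proj₁ w > 0 → proj₁ y ≡ 0
      corner-support₁ {zero , _}            _  _ _ _  = refl
      corner-support₁ {suc _ , _} {zero , _} _ _ _ ()
      corner-support₁ {suc _ , _} {suc _ , _} yL κ e _ =
        contradiction (shared-support₁ yL (proj₁ (proj₂ (corner⇒outer κ)) (s≤s z≤n)) e) (corner∉L κ)

      corner-support₂ : ∀ {y w} → L y → Corner w → y ∙ P ≡ w ∙ P [mod m ] → proj₂ w > 0 → proj₂ y ≡ 0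
      corner-support₂ {_ , zero}            _  _ _ _  = refl
      corner-support₂ {_ , suc _} {_ , zero} _ _ _ ()
      corner-support₂ {_ , suc _} {_ , suc _} yL κ e _ =
        contradiction (shared-support₂ yL (proj₂ (proj₂ (corner⇒outer κ)) (s≤s z≤n)) e) (corner∉L κ)

      R₁ : (a , c) ∙ P ≡ 0 [mod m ]
      R₁ with ∙-surjective ((a , c) ∙ P)
      ... | y , yL , e with corner-support₁ yL (inj₁ refl) e a>0 | corner-support₂ yL (inj₁ refl) e c>0
      ...   | refl | refl = mod-sym e

      ab-image : Σ ℕ λ y₂ → y₂ < c + d × (a + b , 0) ∙ P ≡ (0 , y₂) ∙ P [mod m ]
      ab-image with ∙-surjective ((a + b , 0) ∙ P)
      ... | (y₁ , y₂) , yL , e with refl ← corner-support₁ yL (inj₂ (inj₁ refl)) e a+b>0 = y₂ , L⇒<c+d yL , mod-sym e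

      cd-image : Σ ℕ λ y₁ → y₁ < a + b × (0 , c + d) ∙ P ≡ (y₁ , 0) ∙ P [mod m ]
      cd-image with ∙-surjective ((0 , c + d) ∙ P)
      ... | (y₁ , y₂) , yL , e with refl ← corner-support₂ yL (inj₂ (inj₂ refl)) e c+d>0 = y₁ , L⇒<a+b yL , mod-sym e

      -- Both images force (b , 0) ∙ P ≡ (0 , y₂ + c) ∙ P; injectivity on L then pins y₂ down to d.
      R₂ : (a + b , 0) ∙ P ≡ (0 , d) ∙ P [mod m ]
      R₂ with ab-image | cd-image
      ... | y₂ , y₂<c+d , e₂ | y₁ , y₁<a+b , e₁ = subst (λ t → (a + b , 0) ∙ P ≡ (0 , t) ∙ P [mod m ]) y₂≡d e₂
        where
        open ≡-mod-Reasoning m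
        b≈y₂+c : (b , 0) ∙ P ≡ (0 , y₂ + c) ∙ P [mod m ]
        b≈y₂+c = begin
          b * P₁ + 0                      ≈⟨ +-cong-mod mod-refl R₁ ⟨
          b * P₁ + (a * P₁ + c * P₂)      ≡⟨ solve (a ∷ b ∷ c ∷ P₁ ∷ P₂ ∷ []) ⟩
          ((a + b) * P₁ + 0) + c * P₂     ≈⟨ +-cong-mod e₂ mod-refl ⟩
          y₂ * P₂ + c * P₂                ≡⟨ solve (y₂ ∷ c ∷ P₂ ∷ []) ⟩
          (y₂ + c) * P₂                   ∎
        y₂≡d : y₂ ≡ d
        y₂≡d with c + d ≤? y₂ + c
        ... | no c+d≰y₂+c =
          contradiction (cong proj₁ (∙-injective (inj₁ (m<n+m b a>0 , c>0)) (inj₂ (a>0 , ≰⇒> c+d≰y₂+c)) b≈y₂+c))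
                        (≢-sym (<⇒≢ b>0))
        ... | yes c+d≤y₂+c with m≤n⇒∃[o]m+o≡n c+d≤y₂+c
        ...   | e , c+d+e≡y₂+c with ∙-injective (inj₁ (m<n+m b a>0 , c>0)) (inj₁ (y₁<a+b , e<c)) b≈y₁+e
          where
          e<c : e < c
          e<c = +-cancelˡ-< (c + d) e c (subst (_< c + d + c) (sym c+d+e≡y₂+c) (+-monoˡ-< c y₂<c+d))
          b≈y₁+e : (b , 0) ∙ P ≡ (y₁ , e) ∙ P [mod m ]
          b≈y₁+e = begin
            b * P₁ + 0                    ≈⟨ b≈y₂+c ⟩
            (y₂ + c) * P₂                 ≡⟨ cong (_* P₂) c+d+e≡y₂+c ⟨
            (c + d + e) * P₂              ≡⟨ solve (c ∷ d ∷ e ∷ P₂ ∷ []) ⟩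
            (c + d) * P₂ + e * P₂         ≈⟨ +-cong-mod e₁ mod-refl ⟩
            (y₁ * P₁ + 0) + e * P₂        ≡⟨ solve (y₁ ∷ e ∷ P₁ ∷ P₂ ∷ []) ⟩
            y₁ * P₁ + e * P₂              ∎
        ...     | refl = +-cancelʳ-≡ c y₂ d (trans (sym c+d+e≡y₂+c) (trans (+-identityʳ (c + d)) (+-comm c d)))

      G : ℕ
      G = gcd (gcd a b) (gcd c d)

      instance
        G-nonZero : NonZero G
        G-nonZero = ≢-nonZero (gcd[m,n]≢0 _ _ (inj₁ (gcd[m,n]≢0 a b (inj₁ (≢-sym (<⇒≢ a>0))))))

      ∙-congruent⇒mod-G : ∀ y z → y ∙ P ≡ z ∙ P [mod m ] → proj₁ y ≡ proj₁ z [mod G ] × proj₂ y ≡ proj₂ z [mod G ]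
      ∙-congruent⇒mod-G y z e with reduce y | reduce z
      ... | y′ , y⟶*y′ , y′L | z′ , z⟶*z′ , z′L
        with refl ← ∙-injective y′L z′L
                      (mod-trans (mod-sym (⟶*-∙ P₁ P₂ R₁ R₂ y⟶*y′)) (mod-trans e (⟶*-∙ P₁ P₂ R₁ R₂ z⟶*z′)))
        with ⟶*-mod G∣a G∣b G∣c G∣d y⟶*y′ | ⟶*-mod G∣a G∣b G∣c G∣d z⟶*z′
        where
        G∣a = ∣-trans (gcd[m,n]∣m (gcd a b) (gcd c d)) (gcd[m,n]∣m a b)
        G∣b = ∣-trans (gcd[m,n]∣m (gcd a b) (gcd c d)) (gcd[m,n]∣n a b)
        G∣c = ∣-trans (gcd[m,n]∣n (gcd a b) (gcd c d)) (gcd[m,n]∣m c d)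
        G∣d = ∣-trans (gcd[m,n]∣n (gcd a b) (gcd c d)) (gcd[m,n]∣n c d)
      ... | y₁≈ , y₂≈ | z₁≈ , z₂≈ = mod-trans y₁≈ (mod-sym z₁≈) , mod-trans y₂≈ (mod-sym z₂≈)

      -- If u ∙ P ≡ 1 then P₁ u and P₂ u represent (1 , 0) and (0 , 1) modulo the relations, hence modulo G;
      -- comparing (P₁ u₁) (P₂ u₂) with (P₁ u₂) (P₂ u₁) then gives 1 ≡ 0 modulo G.
      gcd≡1 : G ≡ 1
      gcd≡1 with ∙-surjective 1
      ... | (u₁ , u₂) , _ , u≈1 = 1≡0-mod⇒≡1 (begin
          1 * 1                        ≈⟨ *-cong-mod (mod-sym P₁u₁≈1) (mod-sym P₂u₂≈1) ⟩
          (P₁ * u₁) * (P₂ * u₂)        ≡⟨ solve (P₁ ∷ P₂ ∷ u₁ ∷ u₂ ∷ []) ⟩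
          (P₁ * u₂) * (P₂ * u₁)        ≈⟨ *-cong-mod P₁u₂≈0 P₂u₁≈0 ⟩
          0 * 0                        ∎)
        where
        scaled : ∀ n → (n * u₁ , n * u₂) ∙ P ≡ n [mod m ]
        scaled n = begin
          (n * u₁ , n * u₂) ∙ P         ≡⟨ ∙-scale n u₁ u₂ P₁ P₂ ⟩
          n * (u₁ * P₁ + u₂ * P₂)       ≈⟨ *-cong-mod (mod-refl {x = n}) u≈1 ⟩
          n * 1                         ≡⟨ *-identityʳ n ⟩
          n                             ∎
          where open ≡-mod-Reasoning m
        row₁ = ∙-congruent⇒mod-G (P₁ * u₁ , P₁ * u₂) (1 , 0)
                 (mod-trans (scaled P₁) (mod-reflexive (sym (trans (+-identityʳ (P₁ + 0)) (+-identityʳ P₁)))))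
        row₂ = ∙-congruent⇒mod-G (P₂ * u₁ , P₂ * u₂) (0 , 1) (mod-trans (scaled P₂) (mod-reflexive (sym (+-identityʳ P₂))))
        P₁u₁≈1 = proj₁ row₁
        P₁u₂≈0 = proj₂ row₁
        P₂u₁≈0 = proj₁ row₂
        P₂u₂≈1 = proj₂ row₂
        open ≡-mod-Reasoning G

    bijective⇒2≤m : ∀ {k P₁ P₂} → Bijective (suc k) P₁ P₂ → 2 ≤ suc k
    bijective⇒2≤m {zero} {P₁} {P₂} β
      with () ← Bijective.∙-injective β e₁∈L 0∈L (mod-by (trans (n%1≡0 ((1 , 0) ∙ (P₁ , P₂))) (sym (n%1≡0 0))))
    bijective⇒2≤m {suc _} _ = s≤s (s≤s z≤n)

open Staircases

module KunzNilsemigroups where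

  open import Data.Nat as ℕ using (ℕ; zero; suc)
  open import Data.Integer as ℤ using (0ℤ)
  import Data.Integer.Properties as ℤ
  open import Data.Integer.Tactic.RingSolver using (solve)
  open import Data.Fin using (Fin; toℕ)
  open import Data.List using ([]; _∷_)
  open import Data.Bool using (if_then_else_)
  open import Function using (_∘_)
  open import Data.Maybe using (just; nothing)
  open import Data.Product using (∃; _×_; _,_)
  open import Relation.Nullary using (¬_; yes; no; contradiction)
  open import Relation.Nullary.Decidable using (dec-true; dec-false)
  open import Relation.Binary.PropositionalEquality

  private
    +-cancelˡ-≤ : ∀ i {j k} → i ℤ.+ j ℤ.≤ i ℤ.+ k → j ℤ.≤ k
    +-cancelˡ-≤ i {j} {k} = subst₂ ℤ._≤_ (cancel j) (cancel k) ∘ ℤ.+-monoʳ-≤ (ℤ.- i)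
      where
      cancel : ∀ t → ℤ.- i ℤ.+ (i ℤ.+ t) ≡ t
      cancel t = solve (i ∷ t ∷ [])

  toℕ≡0⇒≡zero : ∀ {k} {i : Fin (suc k)} → toℕ i ≡ 0 → i ≡ Fin.zero
  toℕ≡0⇒≡zero {i = Fin.zero} _ = refl

  module NilProperties {k : ℕ} (K : KunzPoint (suc k)) where
    open KunzPoint K
    open Nil K

    Tight : Fin (suc k) → Fin (suc k) → Set
    Tight u v = x u ℤ.+ x v ≡ x (u +ₘ v)

    x[0]≡0 : x Fin.zero ≡ 0ℤ
    x[0]≡0 = x-zero Fin.zero refl

    ⊕-tight : ∀ {u v} → Tight u v → just u ⊕ just v ≡ just (u +ₘ v)
    ⊕-tight {u} {v} t = cong (λ b → if b then just (u +ₘ v) else nothing) (dec-true (x u ℤ.+ x v ℤ.≟ x (u +ₘ v)) t)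

    ⊕-loose : ∀ {u v} → ¬ Tight u v → just u ⊕ just v ≡ nothing
    ⊕-loose {u} {v} t = cong (λ b → if b then just (u +ₘ v) else nothing) (dec-false (x u ℤ.+ x v ℤ.≟ x (u +ₘ v)) t)

    ⊕-just : ∀ {u v n} → just u ⊕ just v ≡ just n → Tight u v × u +ₘ v ≡ n
    ⊕-just {u} {v} e with x u ℤ.+ x v ℤ.≟ x (u +ₘ v)
    ⊕-just refl | yes t = t , refl
    ⊕-just ()   | no _

    ⊕-nothingʳ : ∀ A → A ⊕ nothing ≡ nothing
    ⊕-nothingʳ nothing  = refl
    ⊕-nothingʳ (just _) = refl

    ⊕-comm : ∀ A B → A ⊕ B ≡ B ⊕ A
    ⊕-comm nothing  B        = sym (⊕-nothingʳ B)
    ⊕-comm (just _) nothing  = refl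
    ⊕-comm (just u) (just v) rewrite +ₘ-comm u v | ℤ.+-comm (x u) (x v) = refl

    tight-zeroʳ : ∀ u {o} → toℕ o ≡ 0 → Tight u o
    tight-zeroʳ u {o} o≡0 rewrite toℕ≡0⇒≡zero o≡0 | x[0]≡0 | +ₘ-identityʳ u = ℤ.+-identityʳ (x u)

    tight-zeroˡ : ∀ {o} v → toℕ o ≡ 0 → Tight o v
    tight-zeroˡ {o} v o≡0 rewrite toℕ≡0⇒≡zero o≡0 | x[0]≡0 | +ₘ-identityˡ v = ℤ.+-identityˡ (x v)

    ⊕-identityʳ : ∀ A → A ⊕ just Fin.zero ≡ A
    ⊕-identityʳ nothing  = refl
    ⊕-identityʳ (just u) = trans (⊕-tight (tight-zeroʳ u refl)) (cong just (+ₘ-identityʳ u))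

    ⊕-identityˡ : ∀ A → just Fin.zero ⊕ A ≡ A
    ⊕-identityˡ A = trans (⊕-comm (just Fin.zero) A) (⊕-identityʳ A)

    -- x (u + (v + w)) ≤ x u + x (v + w) ≤ x u + x v + x w by the cone inequalities, and the two ends agree.
    tight-suffix : ∀ u v w → toℕ u ≢ 0 → toℕ (v +ₘ w) ≢ 0 → toℕ (u +ₘ (v +ₘ w)) ≢ 0 →
                   x u ℤ.+ (x v ℤ.+ x w) ≡ x (u +ₘ (v +ₘ w)) → Tight v w
    tight-suffix u v w u≢0 vw≢0 n≢0 t with toℕ v ℕ.≟ 0 | toℕ w ℕ.≟ 0
    ... | yes v≡0 | _       = tight-zeroˡ w v≡0
    ... | no _    | yes w≡0 = tight-zeroʳ v w≡0
    ... | no v≢0  | no w≢0  = ℤ.≤-antisym ≥-cone (cone v w v≢0 w≢0 vw≢0)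
      where
      ≥-cone : x v ℤ.+ x w ℤ.≤ x (v +ₘ w)
      ≥-cone = +-cancelˡ-≤ (x u) (subst (ℤ._≤ x u ℤ.+ x (v +ₘ w)) (sym t) (cone u (v +ₘ w) u≢0 vw≢0 n≢0))

    ·-toℕ : ∀ n p {q} → n · p ≡ just q → toℕ q ≡ n ℕ.* toℕ p [mod suc k ]
    ·-toℕ zero    p refl = mod-refl
    ·-toℕ (suc n) p {q} e with n · p in e′
    ... | just α with ⊕-just e
    ...   | _ , refl = mod-trans (toℕ-+ₘ p α) (+-cong-mod mod-refl (·-toℕ n p e′))

    module _ (p q : Fin (suc k)) where

      eval-∙ : ∀ z {n} → eval p q z ≡ just n → toℕ n ≡ z ∙ (toℕ p , toℕ q) [mod suc k ]
      eval-∙ (i , j) e with i · p in eᵢ | j · q in eⱼ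
      ... | just α | just β with ⊕-just e
      ...   | _ , refl = mod-trans (toℕ-+ₘ α β) (+-cong-mod (·-toℕ i p eᵢ) (·-toℕ j q eⱼ))

      eval-swap : ∀ i j → eval p q (i , j) ≡ eval q p (j , i)
      eval-swap i j = ⊕-comm (i · p) (j · q)

      eval-00 : eval p q (0 , 0) ≡ just Fin.zero
      eval-00 = ⊕-identityʳ (just Fin.zero)

      eval-10 : eval p q (1 , 0) ≡ just p
      eval-10 = trans (⊕-identityʳ (just p ⊕ just Fin.zero)) (⊕-identityʳ (just p))

    suffix-defined : ∀ p {A B n} → toℕ p ≢ 0 → toℕ n ≢ 0 → n ≢ p →
                     (just p ⊕ A) ⊕ B ≡ just n → ∃ λ n′ → A ⊕ B ≡ just n′
    suffix-defined p {nothing} _ _ _ ()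
    suffix-defined p {just α} {nothing} _ _ _ e = contradiction (trans (sym (⊕-nothingʳ (just p ⊕ just α))) e) λ ()
    suffix-defined p {just α} {just β} p≢0 n≢0 n≢p e with just p ⊕ just α in eₚ
    ... | nothing with () ← e
    ... | just γ with ⊕-just eₚ | ⊕-just e
    ...   | tₚ , refl | tₙ , refl =
      α +ₘ β , ⊕-tight (tight-suffix p α β p≢0 αβ≢0 (n≢0 ∘ subst (λ n → toℕ n ≡ 0) (sym (+ₘ-assoc p α β))) t)
      where
      t : x p ℤ.+ (x α ℤ.+ x β) ≡ x (p +ₘ (α +ₘ β))
      t = begin
        x p ℤ.+ (x α ℤ.+ x β)   ≡⟨ ℤ.+-assoc (x p) (x α) (x β) ⟨
        x p ℤ.+ x α ℤ.+ x β     ≡⟨ cong (ℤ._+ x β) tₚ ⟩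
        x (p +ₘ α) ℤ.+ x β      ≡⟨ tₙ ⟩
        x (p +ₘ α +ₘ β)         ≡⟨ cong x (+ₘ-assoc p α β) ⟩
        x (p +ₘ (α +ₘ β))       ∎
        where open ≡-Reasoning
      αβ≢0 : toℕ (α +ₘ β) ≢ 0
      αβ≢0 αβ≡0 = n≢p (begin
        p +ₘ α +ₘ β             ≡⟨ +ₘ-assoc p α β ⟩
        p +ₘ (α +ₘ β)           ≡⟨ cong (p +ₘ_) (toℕ≡0⇒≡zero αβ≡0) ⟩
        p +ₘ Fin.zero           ≡⟨ +ₘ-identityʳ p ⟩
        p                       ∎)
        where open ≡-Reasoning

    module Downward (p q : Fin (suc k)) (p≢0 : toℕ p ≢ 0)
                    (unique : ∀ {n} z z′ → eval p q z ≡ just n → eval p q z′ ≡ just n → z ≡ z′) where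

      eval≢zero : ∀ i j {n} → eval p q (suc i , j) ≡ just n → toℕ n ≢ 0
      eval≢zero i j e n≡0 with () ← unique (suc i , j) (0 , 0) e (trans (eval-00 p q) (cong just (sym (toℕ≡0⇒≡zero n≡0))))

      eval≢p : ∀ i j {n} → eval p q (suc (suc i) , j) ≡ just n → n ≢ p
      eval≢p i j e refl with () ← unique (suc (suc i) , j) (1 , 0) e (eval-10 p q)

      eval-pred₁ : ∀ i j {n} → eval p q (suc i , j) ≡ just n → ∃ λ n′ → eval p q (i , j) ≡ just n′
      eval-pred₁ zero j e with j · q
      ... | nothing = contradiction (trans (sym (⊕-nothingʳ (just p ⊕ just Fin.zero))) e) λ ()
      ... | just β  = β , ⊕-identityˡ (just β)
      eval-pred₁ (suc i) j e = suffix-defined p {suc i · p} {j · q} p≢0 (eval≢zero (suc i) j e) (eval≢p i j e) e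

open KunzNilsemigroups

module Forward {k : ℕ} (K : KunzPoint (suc k)) (a b c d : ℕ) (a>0 : a > 0) (b>0 : b > 0) (c>0 : c > 0) (d>0 : d > 0)
               (p₁ p₂ : Fin (suc k)) (p₁≢0 : toℕ p₁ ≢ 0) (p₂≢0 : toℕ p₂ ≢ 0)
               (staircase : Nil.Staircase K p₁ p₂)
               (betti : ∀ z → Nil.OuterBetti K p₁ p₂ z ⇔ Shape.Corner a b c d a>0 b>0 c>0 d>0 z) where
  open import Data.Nat using (ℕ; zero; suc; _+_; _>_; pred)
  open import Data.Nat.Properties
  open import Data.Nat.DivMod using (_mod_)
  open import Data.Fin using (Fin; toℕ)
  open import Data.Maybe using (just; nothing)
  open import Data.Product using (Σ; _×_; _,_; proj₁; proj₂)
  open import Function.Bundles using (_⇔_; Equivalence)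
  open import Relation.Nullary using (¬_; yes; no; contradiction)
  open import Relation.Binary.PropositionalEquality

  open Nil K
  open NilProperties K
  open Shape a b c d a>0 b>0 c>0 d>0

  private
    m = suc k
    P₁ = toℕ p₁
    P₂ = toℕ p₂

  P : ℕ × ℕ
  P = (P₁ , P₂)

  Defined : ℕ × ℕ → Set
  Defined z = Σ (Fin m) λ n → eval p₁ p₂ z ≡ just n

  unique : ∀ {n} z z′ → eval p₁ p₂ z ≡ just n → eval p₁ p₂ z′ ≡ just n → z ≡ z′
  unique {n} = proj₂ (staircase n)

  unique-swapped : ∀ {n} z z′ → eval p₂ p₁ z ≡ just n → eval p₂ p₁ z′ ≡ just n → z ≡ z′
  unique-swapped (i , j) (i′ , j′) e e′
    with refl ← unique (j , i) (j′ , i′) (trans (eval-swap p₁ p₂ j i) e) (trans (eval-swap p₁ p₂ j′ i′) e′) = refl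

  defined-pred₁ : ∀ i j → Defined (suc i , j) → Defined (i , j)
  defined-pred₁ i j (_ , e) = Downward.eval-pred₁ p₁ p₂ p₁≢0 unique i j e

  defined-pred₂ : ∀ i j → Defined (i , suc j) → Defined (i , j)
  defined-pred₂ i j (_ , e) with Downward.eval-pred₁ p₂ p₁ p₂≢0 unique-swapped j i (trans (sym (eval-swap p₁ p₂ i (suc j))) e)
  ... | n , e′ = n , trans (eval-swap p₁ p₂ i j) e′

  defined-⊞ˡ : ∀ w δ → Defined (w ⊞ δ) → Defined w
  defined-⊞ˡ (w₁ , w₂) (zero , zero) = subst Defined (cong₂ _,_ (+-identityʳ w₁) (+-identityʳ w₂))
  defined-⊞ˡ (w₁ , w₂) (suc i , j) h =
    defined-⊞ˡ (w₁ , w₂) (i , j) (defined-pred₁ (w₁ + i) (w₂ + j) (subst (λ n → Defined (n , w₂ + j)) (+-suc w₁ i) h))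
  defined-⊞ˡ (w₁ , w₂) (zero , suc j) h =
    defined-⊞ˡ (w₁ , w₂) (0 , j) (defined-pred₂ (w₁ + 0) (w₂ + j) (subst (λ n → Defined (w₁ + 0 , n)) (+-suc w₂ j) h))

  corner-undefined : ∀ {z} → Corner z → ¬ Defined z
  corner-undefined {z} κ (_ , e) with () ← trans (sym (proj₁ (Equivalence.from (betti z) κ))) e

  defined⇒L : ∀ {z} → Defined z → L z
  defined⇒L {z} zD with L? z
  ... | yes zL = zL
  ... | no z∉L with ∉L⇒above-corner z∉L
  ...   | w , δ , κ , refl = contradiction (defined-⊞ˡ w δ zD) (corner-undefined κ)

  -- Were z nil, it would be an outer Betti element, i.e. a corner; but corners lie outside L.
  defined-by-preds : ∀ {z₁ z₂} → L (z₁ , z₂) → (z₁ > 0 → Defined (pred z₁ , z₂)) → (z₂ > 0 → Defined (z₁ , pred z₂)) →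
                     Defined (z₁ , z₂)
  defined-by-preds {z₁} {z₂} zL h₁ h₂ with eval p₁ p₂ (z₁ , z₂) in e
  ... | just n  = n , refl
  ... | nothing = contradiction zL (corner∉L (Equivalence.to (betti (z₁ , z₂)) (e , h₁ , h₂)))

  L⇒defined : ∀ z₁ z₂ → L (z₁ , z₂) → Defined (z₁ , z₂)
  L⇒defined zero    zero    zL = defined-by-preds zL (λ ()) (λ ())
  L⇒defined (suc i) zero    zL = defined-by-preds zL (λ _ → L⇒defined i 0 (L-pred₁ zL)) (λ ())
  L⇒defined zero    (suc j) zL = defined-by-preds zL (λ ()) (λ _ → L⇒defined 0 j (L-pred₂ zL))
  L⇒defined (suc i) (suc j) zL =
    defined-by-preds zL (λ _ → L⇒defined i (suc j) (L-pred₁ zL)) (λ _ → L⇒defined (suc i) j (L-pred₂ zL))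

  ∙-injective : ∀ {y y′} → L y → L y′ → y ∙ P ≡ y′ ∙ P [mod m ] → y ≡ y′
  ∙-injective {y} {y′} yL y′L e with L⇒defined _ _ yL | L⇒defined _ _ y′L
  ... | n , eₙ | n′ , eₙ′
    with refl ← toℕ-mod-injective (mod-trans (eval-∙ p₁ p₂ y eₙ) (mod-trans e (mod-sym (eval-∙ p₁ p₂ y′ eₙ′))))
    = unique y y′ eₙ eₙ′

  ∙-surjective : ∀ N → Σ (ℕ × ℕ) λ y → L y × y ∙ P ≡ N [mod m ]
  ∙-surjective N with proj₁ (staircase (N mod m))
  ... | y , e = y , defined⇒L (_ , e) , mod-trans (mod-sym (eval-∙ p₁ p₂ y e)) (toℕ-mod N)

  bijective : Bijective (suc k) P₁ P₂
  bijective = record { ∙-injective = ∙-injective ; ∙-surjective = ∙-surjective }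

module Backward (a b c d : ℕ) (a>0 : a > 0) (b>0 : b > 0) (c>0 : c > 0) (d>0 : d > 0)
                {k : ℕ} (P₁ P₂ : ℕ) (β : Shape.Bijective a b c d a>0 b>0 c>0 d>0 (suc k) P₁ P₂) where
  open import Data.Nat using (ℕ; zero; suc; _+_; _<_; _≤_; _>_)
  open import Data.Nat.Properties using (+-identityʳ; m+n≡0⇒n≡0; suc-injective; <⇒≢)
  open import Data.Nat.DivMod using (_mod_)
  open import Data.Integer as ℤ using (ℤ; +_; +≤+)
  import Data.Integer.Properties as ℤ
  open import Data.Fin using (Fin; toℕ)
  open import Data.Maybe using (just; nothing)
  open import Data.Product using (Σ; _×_; _,_; proj₁; proj₂)
  open import Data.Sum using (_⊎_; inj₁; inj₂)
  open import Data.Unit using (tt)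
  open import Data.Empty using (⊥-elim)
  open import Function using (_∘_)
  open import Function.Bundles using (_⇔_; mk⇔; Equivalence)
  import Function.Properties.Equivalence as ⇔
  open import Relation.Nullary using (¬_; yes; no; contradiction)
  open import Relation.Binary.PropositionalEquality

  open Shape a b c d a>0 b>0 c>0 d>0
  open Bijective β

  private
    m = suc k
    P = (P₁ , P₂)

  φ : ℕ × ℕ → Fin m
  φ z = (z ∙ P) mod m

  φ-⊞ : ∀ y z → φ (y ⊞ z) ≡ φ y +ₘ φ z
  φ-⊞ y z = toℕ-mod-injective (begin
    toℕ (φ (y ⊞ z))              ≈⟨ toℕ-mod ((y ⊞ z) ∙ P) ⟩
    (y ⊞ z) ∙ P                  ≡⟨ ∙-distribʳ-⊞ y z P ⟩
    y ∙ P + z ∙ P                ≈⟨ +-cong-mod (toℕ-mod (y ∙ P)) (toℕ-mod (z ∙ P)) ⟨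
    toℕ (φ y) + toℕ (φ z)        ≈⟨ toℕ-+ₘ (φ y) (φ z) ⟨
    toℕ (φ y +ₘ φ z)             ∎)
    where open ≡-mod-Reasoning m

  rep : Fin m → ℕ × ℕ
  rep n = proj₁ (∙-surjective (toℕ n))

  rep∈L : ∀ n → L (rep n)
  rep∈L n = proj₁ (proj₂ (∙-surjective (toℕ n)))

  rep-∙ : ∀ n → rep n ∙ P ≡ toℕ n [mod m ]
  rep-∙ n = proj₂ (proj₂ (∙-surjective (toℕ n)))

  φ-rep : ∀ n → φ (rep n) ≡ n
  φ-rep n = toℕ-mod-injective (mod-trans (toℕ-mod (rep n ∙ P)) (rep-∙ n))

  rep-φ : ∀ {y} → L y → rep (φ y) ≡ y
  rep-φ {y} yL = ∙-injective (rep∈L (φ y)) yL (mod-trans (rep-∙ (φ y)) (toℕ-mod (y ∙ P)))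

  rep-zero : rep Fin.zero ≡ (0 , 0)
  rep-zero = rep-φ 0∈L

  rep-⊞ : ∀ i j → L (rep i ⊞ rep j) → rep (i +ₘ j) ≡ rep i ⊞ rep j
  rep-⊞ i j ⊞∈L = begin
    rep (i +ₘ j)                 ≡⟨ cong₂ (λ u v → rep (u +ₘ v)) (φ-rep i) (φ-rep j) ⟨
    rep (φ (rep i) +ₘ φ (rep j)) ≡⟨ cong rep (φ-⊞ (rep i) (rep j)) ⟨
    rep (φ (rep i ⊞ rep j))      ≡⟨ rep-φ ⊞∈L ⟩
    rep i ⊞ rep j                ∎
    where open ≡-Reasoning

  ⊞-reduces-to-rep : ∀ i j → rep i ⊞ rep j ⟶* rep (i +ₘ j)
  ⊞-reduces-to-rep i j with reduce (rep i ⊞ rep j)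
  ... | y , ⊞⟶*y , y∈L = subst (rep i ⊞ rep j ⟶*_) (∙-injective y∈L (rep∈L (i +ₘ j)) y≈) ⊞⟶*y
    where
    open ≡-mod-Reasoning m
    y≈ : y ∙ P ≡ rep (i +ₘ j) ∙ P [mod m ]
    y≈ = begin
      y ∙ P                         ≈⟨ ⟶*-∙ P₁ P₂ R₁ R₂ ⊞⟶*y ⟨
      (rep i ⊞ rep j) ∙ P           ≡⟨ ∙-distribʳ-⊞ (rep i) (rep j) P ⟩
      rep i ∙ P + rep j ∙ P         ≈⟨ +-cong-mod (rep-∙ i) (rep-∙ j) ⟩
      toℕ i + toℕ j                 ≈⟨ toℕ-+ₘ i j ⟨
      toℕ (i +ₘ j)                  ≈⟨ rep-∙ (i +ₘ j) ⟨
      rep (i +ₘ j) ∙ P              ∎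

  height : Fin m → ℤ
  height n = + W (rep n)

  height-cone : ∀ i j → height (i +ₘ j) ℤ.≤ height i ℤ.+ height j
  height-cone i j = +≤+ (subst (W (rep (i +ₘ j)) ≤_) (W-⊞ (rep i) (rep j)) (W-⟶* (⊞-reduces-to-rep i j)))

  height-tight : ∀ i j → L (rep i ⊞ rep j) → height i ℤ.+ height j ≡ height (i +ₘ j)
  height-tight i j ⊞∈L = cong +_ (trans (sym (W-⊞ (rep i) (rep j))) (cong W (sym (rep-⊞ i j ⊞∈L))))

  height-loose : ∀ i j → ¬ L (rep i ⊞ rep j) → height i ℤ.+ height j ≢ height (i +ₘ j)
  height-loose i j ⊞∉L e =
    <⇒≢ (W-⟶*-strict (⊞-reduces-to-rep i j) rep≢⊞) (trans (ℤ.+-injective (sym e)) (sym (W-⊞ (rep i) (rep j))))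
    where
    rep≢⊞ : rep (i +ₘ j) ≢ rep i ⊞ rep j
    rep≢⊞ e′ = ⊞∉L (subst L e′ (rep∈L (i +ₘ j)))

  K : KunzPoint m
  K = record
    { x            = height
    ; x-zero       = λ i i≡0 → trans (cong height (toℕ≡0⇒≡zero i≡0)) (cong (+_ ∘ W) rep-zero)
    ; cone         = λ i j _ _ _ → height-cone i j
    ; trivialGroup = λ i i≢0 h≡0 → i≢0 (cong toℕ (begin
        i                ≡⟨ φ-rep i ⟨
        φ (rep i)        ≡⟨ cong φ (W≡0 {rep i} (ℤ.+-injective h≡0)) ⟩
        φ (0 , 0)        ∎))
    }
    where open ≡-Reasoning

  open Nil K
  open NilProperties K using (⊕-tight; ⊕-loose)

  image : ℕ × ℕ → Elem
  image z with L? z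
  ... | yes _ = just (φ z)
  ... | no _  = nothing

  image-L : ∀ {z} → L z → image z ≡ just (φ z)
  image-L {z} z∈L with L? z
  ... | yes _   = refl
  ... | no z∉L  = contradiction z∈L z∉L

  image-∉L : ∀ {z} → ¬ L z → image z ≡ nothing
  image-∉L {z} z∉L with L? z
  ... | yes z∈L = contradiction z∈L z∉L
  ... | no _    = refl

  image-just : ∀ {z n} → image z ≡ just n → L z × φ z ≡ n
  image-just {z} e with L? z
  image-just refl | yes z∈L = z∈L , refl
  image-just ()   | no _

  image-rep : ∀ n → image (rep n) ≡ just n
  image-rep n = trans (image-L (rep∈L n)) (cong just (φ-rep n))

  image-⊞ : ∀ y z → image y ⊕ image z ≡ image (y ⊞ z)
  image-⊞ y z with L? y | L? z
  ... | no y∉L | _ = sym (image-∉L (y∉L ∘ L-⊞ˡ y z))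
  ... | yes _  | no z∉L = sym (image-∉L (z∉L ∘ L-⊞ʳ y z))
  ... | yes y∈L | yes z∈L with L? (y ⊞ z)
  ...   | yes ⊞∈L = trans (⊕-tight (height-tight (φ y) (φ z) (subst L (sym reps) ⊞∈L))) (cong just (sym (φ-⊞ y z)))
    where reps = cong₂ _⊞_ (rep-φ y∈L) (rep-φ z∈L)
  ...   | no ⊞∉L  = ⊕-loose (height-loose (φ y) (φ z) (⊞∉L ∘ subst L reps))
    where reps = cong₂ _⊞_ (rep-φ y∈L) (rep-φ z∈L)

  p₁ p₂ : Fin m
  p₁ = φ (1 , 0)
  p₂ = φ (0 , 1)

  ·p₁ : ∀ n → n · p₁ ≡ image (n , 0)
  ·p₁ zero    = sym (image-L 0∈L)
  ·p₁ (suc n) = trans (cong₂ _⊕_ (sym (image-L e₁∈L)) (·p₁ n)) (image-⊞ (1 , 0) (n , 0))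

  ·p₂ : ∀ n → n · p₂ ≡ image (0 , n)
  ·p₂ zero    = sym (image-L 0∈L)
  ·p₂ (suc n) = trans (cong₂ _⊕_ (sym (image-L e₂∈L)) (·p₂ n)) (image-⊞ (0 , 1) (0 , n))

  eval-image : ∀ z → eval p₁ p₂ z ≡ image z
  eval-image (z₁ , z₂) = begin
    (z₁ · p₁) ⊕ (z₂ · p₂)          ≡⟨ cong₂ _⊕_ (·p₁ z₁) (·p₂ z₂) ⟩
    image (z₁ , 0) ⊕ image (0 , z₂) ≡⟨ image-⊞ (z₁ , 0) (0 , z₂) ⟩
    image (z₁ + 0 , z₂)             ≡⟨ cong (λ t → image (t , z₂)) (+-identityʳ z₁) ⟩
    image (z₁ , z₂)                 ∎
    where open ≡-Reasoning

  factorization-unique : ∀ {z n} → eval p₁ p₂ z ≡ just n → z ≡ rep n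
  factorization-unique {z} e with image-just (trans (sym (eval-image z)) e)
  ... | z∈L , refl = sym (rep-φ z∈L)

  staircase : Staircase p₁ p₂
  staircase n = (rep n , trans (eval-image (rep n)) (image-rep n)) ,
                λ z z′ e e′ → trans (factorization-unique e) (sym (factorization-unique e′))

  defined⇔L : ∀ z → (Σ (Fin m) λ n → eval p₁ p₂ z ≡ just n) ⇔ L z
  defined⇔L z = mk⇔ (λ (_ , e) → proj₁ (image-just (trans (sym (eval-image z)) e)))
                    (λ z∈L → φ z , trans (eval-image z) (image-L z∈L))

  outerBetti⇔corner : ∀ z → OuterBetti p₁ p₂ z ⇔ Corner z
  outerBetti⇔corner z = ⇔.trans (mk⇔ to from) (outer⇔corner z)
    where
    to : OuterBetti p₁ p₂ z → OuterCorner z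
    to (e , h₁ , h₂) = (λ z∈L → contradiction (trans (sym e) (trans (eval-image z) (image-L z∈L))) λ ())
                     , Equivalence.to (defined⇔L _) ∘ h₁ , Equivalence.to (defined⇔L _) ∘ h₂
    from : OuterCorner z → OuterBetti p₁ p₂ z
    from (z∉L , h₁ , h₂) = trans (eval-image z) (image-∉L z∉L)
                         , Equivalence.from (defined⇔L _) ∘ h₁ , Equivalence.from (defined⇔L _) ∘ h₂

  rep≡0 : ∀ {i} → rep i ≡ (0 , 0) → i ≡ Fin.zero
  rep≡0 {i} e = trans (sym (φ-rep i)) (cong φ e)

  φ-nonzero : ∀ {y} → L y → y ≢ (0 , 0) → toℕ (φ y) ≢ 0
  φ-nonzero {y} y∈L y≢0 φy≡0 = y≢0 (trans (sym (rep-φ y∈L)) (trans (cong rep (toℕ≡0⇒≡zero φy≡0)) rep-zero))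

  ⊞-unit : ∀ y z → y ⊞ z ≡ (1 , 0) ⊎ y ⊞ z ≡ (0 , 1) → y ≡ (0 , 0) ⊎ z ≡ (0 , 0)
  ⊞-unit (zero , zero) _ _ = inj₁ refl
  ⊞-unit (suc y₁ , y₂) (z₁ , z₂) (inj₁ e) =
    inj₂ (cong₂ _,_ (m+n≡0⇒n≡0 y₁ (suc-injective (cong proj₁ e))) (m+n≡0⇒n≡0 y₂ (cong proj₂ e)))
  ⊞-unit (zero , suc y₂) (z₁ , z₂) (inj₂ e) =
    inj₂ (cong₂ _,_ (cong proj₁ e) (m+n≡0⇒n≡0 y₂ (suc-injective (cong proj₂ e))))

  unit-atom : ∀ n → rep n ≡ (1 , 0) ⊎ rep n ≡ (0 , 1) → Atom (just n)
  unit-atom n unit = n≢0 , irreducible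
    where
    n≢0 : toℕ n ≢ 0
    n≢0 n≡0 = unit≢0 unit (trans (cong rep (toℕ≡0⇒≡zero n≡0)) rep-zero)
      where
      unit≢0 : ∀ {r} → r ≡ (1 , 0) ⊎ r ≡ (0 , 1) → r ≢ (0 , 0)
      unit≢0 (inj₁ refl) ()
      unit≢0 (inj₂ refl) ()
    irreducible : ∀ v w → NonZeroE v → NonZeroE w → v ⊕ w ≢ just n
    irreducible nothing  _        _ _ ()
    irreducible (just i) nothing  _ _ ()
    irreducible (just i) (just j) i≢0 j≢0 e
      with image-just (trans (sym (image-⊞ (rep i) (rep j))) (trans (cong₂ _⊕_ (image-rep i) (image-rep j)) e))
    ... | ⊞∈L , refl with ⊞-unit (rep i) (rep j) (subst (λ r → r ≡ (1 , 0) ⊎ r ≡ (0 , 1)) (rep-φ ⊞∈L) unit)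
    ...   | inj₁ e′ = i≢0 (cong toℕ (rep≡0 e′))
    ...   | inj₂ e′ = j≢0 (cong toℕ (rep≡0 e′))

  reducible : ∀ i y z → rep i ≡ y ⊞ z → y ≢ (0 , 0) → z ≢ (0 , 0) → ¬ Atom (just i)
  reducible i y z e y≢0 z≢0 (_ , irreducible) =
    irreducible (just (φ y)) (just (φ z)) (φ-nonzero y∈L y≢0) (φ-nonzero z∈L z≢0) sum
    where
    ⊞∈L = subst L e (rep∈L i)
    y∈L = L-⊞ˡ y z ⊞∈L
    z∈L = L-⊞ʳ y z ⊞∈L
    sum : just (φ y) ⊕ just (φ z) ≡ just i
    sum = begin
      just (φ y) ⊕ just (φ z)   ≡⟨ cong₂ _⊕_ (image-L y∈L) (image-L z∈L) ⟨
      image y ⊕ image z         ≡⟨ image-⊞ y z ⟩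
      image (y ⊞ z)             ≡⟨ cong image e ⟨
      image (rep i)             ≡⟨ image-rep i ⟩
      just i                    ∎
      where open ≡-Reasoning

  atoms : ∀ u → Atom u → u ≡ just p₁ ⊎ u ≡ just p₂
  atoms nothing (_ , irreducible) = ⊥-elim (irreducible nothing nothing tt tt refl)
  atoms (just i) A@(i≢0 , _) with rep i in e
  ... | zero , zero             = ⊥-elim (i≢0 (cong toℕ (rep≡0 e)))
  ... | suc zero , zero         = inj₁ (cong just (trans (sym (φ-rep i)) (cong φ e)))
  ... | zero , suc zero         = inj₂ (cong just (trans (sym (φ-rep i)) (cong φ e)))
  ... | suc (suc r) , s         = ⊥-elim (reducible i (1 , 0) (suc r , s) e (λ ()) (λ ()) A)
  ... | suc zero , suc s        = ⊥-elim (reducible i (1 , 0) (0 , suc s) e (λ ()) (λ ()) A)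
  ... | zero , suc (suc s)      = ⊥-elim (reducible i (0 , 1) (0 , suc s) e (λ ()) (λ ()) A)

  shape : HasShape a b c d
  shape = p₁ , p₂ , p₁≢p₂ , unit-atom p₁ (inj₁ (rep-φ e₁∈L)) , unit-atom p₂ (inj₂ (rep-φ e₂∈L)) ,
          atoms , staircase , outerBetti⇔corner
    where
    p₁≢p₂ : p₁ ≢ p₂
    p₁≢p₂ e with () ← trans (sym (rep-φ e₁∈L)) (trans (cong rep e) (rep-φ e₂∈L))

module IntegerCongruence where

  open import Data.Nat as ℕ using (ℕ; suc; NonZero)
  open import Data.Nat.DivMod using (_%_; _/_; m≡m%n+[m/n]*n)
  open import Data.Integer as ℤ using (ℤ; +_; -[1+_]; _+_; _-_; _*_; -_; 0ℤ; 1ℤ)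
  import Data.Integer.Properties as ℤ
  import Data.Integer.Divisibility.Signed as ℤ∣
  open ℤ∣ using (_∣_; divides)
  open import Data.Integer.DivMod using (_%ℕ_; _/ℕ_; a≡a%ℕn+[a/ℕn]*n)
  open import Data.Integer.Tactic.RingSolver using (solve)
  open import Data.List using ([]; _∷_)
  open import Data.Product using (_,_)
  open import Relation.Binary.Bundles using (Setoid)
  open import Relation.Binary.PropositionalEquality

  infix 4 _≡_[modℤ_]
  record _≡_[modℤ_] (x y : ℤ) (n : ℕ) : Set where
    constructor modℤ
    field ∣-difference : + n ∣ x - y

  module _ {n : ℕ} where

    modℤ-reflexive : ∀ {x y} → x ≡ y → x ≡ y [modℤ n ]
    modℤ-reflexive {x} refl = modℤ (divides 0ℤ (ℤ.+-inverseʳ x))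

    modℤ-refl : ∀ {x} → x ≡ x [modℤ n ]
    modℤ-refl {x} = modℤ-reflexive {x} refl

    modℤ-sym : ∀ {x y} → x ≡ y [modℤ n ] → y ≡ x [modℤ n ]
    modℤ-sym {x} {y} (modℤ p) = modℤ (subst (+ n ∣_) (neg-diff x y) (ℤ∣.∣m⇒∣-m p))
      where
      neg-diff : ∀ x y → - (x - y) ≡ y - x
      neg-diff x y = solve (x ∷ y ∷ [])

    modℤ-trans : ∀ {x y z} → x ≡ y [modℤ n ] → y ≡ z [modℤ n ] → x ≡ z [modℤ n ]
    modℤ-trans {x} {y} {z} (modℤ p) (modℤ q) = modℤ (subst (+ n ∣_) (telescope x y z) (ℤ∣.∣m∣n⇒∣m+n p q))
      where
      telescope : ∀ x y z → (x - y) + (y - z) ≡ x - z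
      telescope x y z = solve (x ∷ y ∷ z ∷ [])

    modℤ-setoid : Setoid _ _
    modℤ-setoid = record
      { Carrier = ℤ
      ; _≈_ = _≡_[modℤ n ]
      ; isEquivalence = record { refl = modℤ-refl ; sym = modℤ-sym ; trans = modℤ-trans }
      }

    +-cong-modℤ : ∀ {x x′ y y′} → x ≡ x′ [modℤ n ] → y ≡ y′ [modℤ n ] → x + y ≡ x′ + y′ [modℤ n ]
    +-cong-modℤ {x} {x′} {y} {y′} (modℤ p) (modℤ q) = modℤ (subst (+ n ∣_) (regroup x x′ y y′) (ℤ∣.∣m∣n⇒∣m+n p q))
      where
      regroup : ∀ x x′ y y′ → (x - x′) + (y - y′) ≡ (x + y) - (x′ + y′)
      regroup x x′ y y′ = solve (x ∷ x′ ∷ y ∷ y′ ∷ [])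

    *-cong-modℤ : ∀ {x x′ y y′} → x ≡ x′ [modℤ n ] → y ≡ y′ [modℤ n ] → x * y ≡ x′ * y′ [modℤ n ]
    *-cong-modℤ {x} {x′} {y} {y′} (modℤ p) (modℤ q) =
      modℤ (subst (+ n ∣_) (regroup x x′ y y′) (ℤ∣.∣m∣n⇒∣m+n (ℤ∣.∣n⇒∣m*n x q) (ℤ∣.∣n⇒∣m*n y′ p)))
      where
      regroup : ∀ x x′ y y′ → x * (y - y′) + y′ * (x - x′) ≡ x * y - x′ * y′
      regroup x x′ y y′ = solve (x ∷ x′ ∷ y ∷ y′ ∷ [])

    n≡0-modℤ : + n ≡ 0ℤ [modℤ n ]
    n≡0-modℤ = modℤ (divides 1ℤ (trans (ℤ.+-identityʳ (+ n)) (sym (ℤ.*-identityˡ (+ n)))))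

    %ℕ-modℤ : .{{_ : NonZero n}} → ∀ x → + (x %ℕ n) ≡ x [modℤ n ]
    %ℕ-modℤ x = modℤ (divides (- (x /ℕ n)) (begin
      + (x %ℕ n) - x                                  ≡⟨ cong (λ u → + (x %ℕ n) - u) (a≡a%ℕn+[a/ℕn]*n x n) ⟩
      + (x %ℕ n) - (+ (x %ℕ n) + (x /ℕ n) * + n)      ≡⟨ cancel (+ (x %ℕ n)) (x /ℕ n) (+ n) ⟩
      - (x /ℕ n) * + n                                ∎))
      where
      open ≡-Reasoning
      cancel : ∀ r q k → r - (r + q * k) ≡ - q * k
      cancel r q k = solve (r ∷ q ∷ k ∷ [])

  module ≡-modℤ-Reasoning (n : ℕ) where
    open import Relation.Binary.Reasoning.Setoid (modℤ-setoid {n}) public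

  private
    add-difference : ∀ x y → x ≡ y + (x - y)
    add-difference x y = solve (x ∷ y ∷ [])

    sub-difference : ∀ x y → y ≡ x - (x - y)
    sub-difference x y = solve (x ∷ y ∷ [])

    difference-of-shifts : ∀ r x y k → (r + x * k) - (r + y * k) ≡ (x - y) * k
    difference-of-shifts r x y k = solve (r ∷ x ∷ y ∷ k ∷ [])

  pos-difference : ∀ {x y n} → + x - + y ≡ + n → x ≡ y ℕ.+ n
  pos-difference {x} {y} {n} e = ℤ.+-injective (begin
    + x                ≡⟨ add-difference (+ x) (+ y) ⟩
    + y + (+ x - + y)  ≡⟨ cong (λ u → + y + u) e ⟩
    + y + + n          ≡⟨ ℤ.pos-+ y n ⟨
    + (y ℕ.+ n)        ∎)
    where open ≡-Reasoning

  neg-difference : ∀ {x y n} → + x - + y ≡ - + n → y ≡ x ℕ.+ n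
  neg-difference {x} {y} {n} e = ℤ.+-injective (begin
    + y                ≡⟨ sub-difference (+ x) (+ y) ⟩
    + x - (+ x - + y)  ≡⟨ cong (λ u → + x - u) e ⟩
    + x - - + n        ≡⟨ cong (λ u → + x + u) (ℤ.neg-involutive (+ n)) ⟩
    + x + + n          ≡⟨ ℤ.pos-+ x n ⟨
    + (x ℕ.+ n)        ∎)
    where open ≡-Reasoning

  module _ {n : ℕ} .{{_ : NonZero n}} where

    mod⇒modℤ : ∀ {X Y} → X ≡ Y [mod n ] → + X ≡ + Y [modℤ n ]
    mod⇒modℤ {X} {Y} (mod-by e) = modℤ (divides (+ (X / n) - + (Y / n)) (begin
      + X - + Y                                                 ≡⟨ cong₂ (λ u v → + u - + v) (m≡m%n+[m/n]*n X n) (m≡m%n+[m/n]*n Y n) ⟩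
      + (X % n ℕ.+ X / n ℕ.* n) - + (Y % n ℕ.+ Y / n ℕ.* n)     ≡⟨ cong (λ u → + (u ℕ.+ X / n ℕ.* n) - + (Y % n ℕ.+ Y / n ℕ.* n)) e ⟩
      + (Y % n ℕ.+ X / n ℕ.* n) - + (Y % n ℕ.+ Y / n ℕ.* n)     ≡⟨ cong₂ _-_ (cast (Y % n) (X / n)) (cast (Y % n) (Y / n)) ⟩
      (+ (Y % n) + + (X / n) * + n) - (+ (Y % n) + + (Y / n) * + n) ≡⟨ difference-of-shifts (+ (Y % n)) (+ (X / n)) (+ (Y / n)) (+ n) ⟩
      (+ (X / n) - + (Y / n)) * + n                             ∎))
      where
      open ≡-Reasoning
      cast : ∀ r q → + (r ℕ.+ q ℕ.* n) ≡ + r + + q * + n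
      cast r q = trans (ℤ.pos-+ r (q ℕ.* n)) (cong (λ w → + r + w) (ℤ.pos-* q n))

    modℤ⇒mod : ∀ {X Y} → + X ≡ + Y [modℤ n ] → X ≡ Y [mod n ]
    modℤ⇒mod {X} {Y} (modℤ (divides (+ q) e)) =
      mod-trans (mod-reflexive (pos-difference (trans e (sym (ℤ.pos-* q n))))) (+-*-mod Y q)
    modℤ⇒mod {X} {Y} (modℤ (divides -[1+ q ] e)) = mod-sym (mod-trans (mod-reflexive Y≡) (+-*-mod X (suc q)))
      where
      Y≡ : Y ≡ X ℕ.+ suc q ℕ.* n
      Y≡ = neg-difference (trans e (trans (sym (ℤ.neg-distribˡ-* (+ suc q) (+ n))) (cong -_ (sym (ℤ.pos-* (suc q) n)))))

  pos-∙ : ∀ z₁ z₂ X₁ X₂ → + ((z₁ , z₂) ∙ (X₁ , X₂)) ≡ + z₁ * + X₁ + + z₂ * + X₂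
  pos-∙ z₁ z₂ X₁ X₂ = trans (ℤ.pos-+ (z₁ ℕ.* X₁) (z₂ ℕ.* X₂)) (cong₂ _+_ (ℤ.pos-* z₁ X₁) (ℤ.pos-* z₂ X₂))

  ∙-%ℕ : ∀ {n} .{{_ : NonZero n}} z₁ z₂ x₁ x₂ → + ((z₁ , z₂) ∙ (x₁ %ℕ n , x₂ %ℕ n)) ≡ + z₁ * x₁ + + z₂ * x₂ [modℤ n ]
  ∙-%ℕ {n} z₁ z₂ x₁ x₂ = begin
    + ((z₁ , z₂) ∙ (x₁ %ℕ n , x₂ %ℕ n))         ≡⟨ pos-∙ z₁ z₂ (x₁ %ℕ n) (x₂ %ℕ n) ⟩
    + z₁ * + (x₁ %ℕ n) + + z₂ * + (x₂ %ℕ n)     ≈⟨ +-cong-modℤ (*-cong-modℤ (modℤ-refl {x = + z₁}) (%ℕ-modℤ x₁))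
                                                               (*-cong-modℤ (modℤ-refl {x = + z₂}) (%ℕ-modℤ x₂)) ⟩
    + z₁ * x₁ + + z₂ * x₂                       ∎
    where open ≡-modℤ-Reasoning n

open IntegerCongruence

module Coprimality where

  open import Data.Nat as ℕ using (ℕ; zero; suc; z≤n; s≤s)
  import Data.Nat.Properties as ℕ
  open import Data.Nat.Divisibility using (_∣_; divides; ∣-refl; ∣-trans; ∣m+n∣m⇒∣n; ∣m⇒∣m*n)
  open import Data.Nat.GCD using (gcd; gcd[m,n]∣m; gcd[m,n]∣n; gcd[m,n]≡0⇒m≡0; module Bézout)
  open import Data.Nat.Coprimality using (Coprime; coprime-divisor; gcd≡1⇒coprime)
  open import Data.Nat.Induction using (<-wellFounded)
  open import Data.Integer using (+_; _+_; _*_; -_; 1ℤ)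
  import Data.Integer.Properties as ℤ
  open import Data.Integer.Tactic.RingSolver using (solve)
  open import Data.List using ([]; _∷_)
  open import Data.Product using (∃; ∃₂; _×_; _,_)
  open import Induction.WellFounded using (Acc; acc)
  open import Relation.Nullary using (contradiction)
  open import Relation.Binary.PropositionalEquality

  bézout : ∀ {m n} → Bézout.Identity 1 m n → ∃₂ λ x y → x * + m + y * + n ≡ 1ℤ
  bézout {m} {n} (Bézout.+- x y eq) = + x , - + y , (begin
    + x * + m + - + y * + n       ≡⟨ cong (_+ - + y * + n) (ℤ.pos-* x m) ⟨
    + (x ℕ.* m) + - + y * + n     ≡⟨ cong (λ w → + w + - + y * + n) eq ⟨
    + (1 ℕ.+ y ℕ.* n) + - + y * + n ≡⟨ cong (_+ - + y * + n) (trans (ℤ.pos-+ 1 (y ℕ.* n)) (cong (λ w → 1ℤ + w) (ℤ.pos-* y n))) ⟩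
    1ℤ + + y * + n + - + y * + n  ≡⟨ cancel-+- 1ℤ (+ y) (+ n) ⟩
    1ℤ                            ∎)
    where
    open ≡-Reasoning
    cancel-+- : ∀ u y n → u + y * n + - y * n ≡ u
    cancel-+- u y n = solve (u ∷ y ∷ n ∷ [])
  bézout {m} {n} (Bézout.-+ x y eq) = - + x , + y , (begin
    - + x * + m + + y * + n       ≡⟨ cong (λ w → - + x * + m + w) (ℤ.pos-* y n) ⟨
    - + x * + m + + (y ℕ.* n)     ≡⟨ cong (λ w → - + x * + m + + w) eq ⟨
    - + x * + m + + (1 ℕ.+ x ℕ.* m) ≡⟨ cong (λ w → - + x * + m + w) (trans (ℤ.pos-+ 1 (x ℕ.* m)) (cong (λ w → 1ℤ + w) (ℤ.pos-* x m))) ⟩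
    - + x * + m + (1ℤ + + x * + m) ≡⟨ cancel--+ 1ℤ (+ x) (+ m) ⟩
    1ℤ                            ∎)
    where
    open ≡-Reasoning
    cancel--+ : ∀ u x m → - x * m + (u + x * m) ≡ u
    cancel--+ u x m = solve (u ∷ x ∷ m ∷ [])

  CoprimePart : ℕ → ℕ → ℕ → Set
  CoprimePart A N N₀ = N₀ ∣ N × Coprime N₀ A × (∀ {e} → e ∣ N → Coprime e A → Coprime e N₀ → e ≡ 1)

  -- Dividing out gcd (N , A) until nothing is left gives the largest divisor of N coprime to A.
  coprime-part : ∀ A N → N ≢ 0 → ∃ (CoprimePart A N)
  coprime-part A N N≢0 = go N N≢0 (<-wellFounded N)
    where
    go : ∀ N → N ≢ 0 → Acc ℕ._<_ N → ∃ (CoprimePart A N)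
    go N N≢0 (acc rec) with gcd N A in g≡ | gcd[m,n]∣m N A | gcd[m,n]∣n N A
    ... | zero | _ | _ = contradiction (gcd[m,n]≡0⇒m≡0 g≡) N≢0
    ... | suc zero | _ | _ = N , ∣-refl , gcd≡1⇒coprime g≡ , λ e∣N _ e⊥N → e⊥N (∣-refl , e∣N)
    ... | g@(suc (suc _)) | divides N₁ N≡N₁g | g∣A with go N₁ N₁≢0 (rec N₁<N)
      where
      N₁≢0 : N₁ ≢ 0
      N₁≢0 N₁≡0 = N≢0 (trans N≡N₁g (cong (ℕ._* g) N₁≡0))
      N₁<N : N₁ ℕ.< N
      N₁<N = subst (N₁ ℕ.<_) (sym N≡N₁g) (ℕ.m<m*n N₁ g {{ℕ.≢-nonZero N₁≢0}} (s≤s (s≤s z≤n)))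
    ... | N₀ , N₀∣N₁ , N₀⊥A , maximal =
      N₀ , ∣-trans N₀∣N₁ (divides g N≡gN₁) , N₀⊥A ,
      λ {e} e∣N e⊥A e⊥N₀ → maximal (coprime-divisor (λ (f∣e , f∣g) → e⊥A (f∣e , ∣-trans f∣g g∣A))
                                                    (subst (e ∣_) N≡gN₁ e∣N)) e⊥A e⊥N₀
      where
      N≡gN₁ : N ≡ g ℕ.* N₁
      N≡gN₁ = trans N≡N₁g (ℕ.*-comm N₁ g)

  -- Choosing s = N₀ kills every common factor of A + s B and N.
  coprime-shift : ∀ A B N → N ≢ 0 → (∀ {e} → e ∣ A → e ∣ B → e ∣ N → e ≡ 1) →
                  ∃ λ s → Coprime (A ℕ.+ s ℕ.* B) N
  coprime-shift A B N N≢0 no-common-factor with coprime-part A N N≢0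
  ... | N₀ , N₀∣N , N₀⊥A , maximal = N₀ , λ (e∣t , e∣N) → maximal e∣N (e⊥A e∣t e∣N) (e⊥N₀ e∣t)
    where
    f∣A : ∀ {e f} → e ∣ A ℕ.+ N₀ ℕ.* B → f ∣ e → f ∣ N₀ ℕ.* B → f ∣ A
    f∣A {e} {f} e∣t f∣e = ∣m+n∣m⇒∣n (subst (f ∣_) (ℕ.+-comm A (N₀ ℕ.* B)) (∣-trans f∣e e∣t))
    e⊥N₀ : ∀ {e} → e ∣ A ℕ.+ N₀ ℕ.* B → Coprime e N₀
    e⊥N₀ e∣t (f∣e , f∣N₀) = N₀⊥A (f∣N₀ , f∣A e∣t f∣e (∣m⇒∣m*n B f∣N₀))
    e⊥A : ∀ {e} → e ∣ A ℕ.+ N₀ ℕ.* B → e ∣ N → Coprime e A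
    e⊥A e∣t e∣N (f∣e , f∣A′) = no-common-factor f∣A′ f∣B (∣-trans f∣e e∣N)
      where
      f∣N₀B = ∣m+n∣m⇒∣n (∣-trans f∣e e∣t) f∣A′
      f∣B = coprime-divisor (λ (g∣f , g∣N₀) → e⊥N₀ e∣t (∣-trans g∣f f∣e , g∣N₀)) f∣N₀B

open Coprimality

module SmithForm where

  open import Data.Integer using (ℤ; _+_; _-_; _*_; 1ℤ; NonZero)
  import Data.Integer.Properties as ℤ
  open import Data.Integer.Tactic.RingSolver using (solve)
  open import Data.List using ([]; _∷_)
  open import Data.Product using (∃₂; _×_; _,_)
  open import Relation.Binary.PropositionalEquality

  -- The lattice spanned by (a , c) and (- b , c + d) is cut out by the columns of the adjugate matrix.
  adjugate : ∀ a b c d D₁ D₂ I J .{{_ : NonZero (a * (c + d) + b * c)}} →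
             (c + d) * D₁ + b * D₂ ≡ (a * (c + d) + b * c) * I →
             a * D₂ - c * D₁ ≡ (a * (c + d) + b * c) * J →
             D₁ ≡ I * a - J * b × D₂ ≡ I * c + J * (c + d)
  adjugate a b c d D₁ D₂ I J ψ₀ ψ₁ =
      ℤ.*-cancelˡ-≡ (a * (c + d) + b * c) D₁ (I * a - J * b) (begin
        (a * (c + d) + b * c) * D₁                                 ≡⟨ solve (a ∷ b ∷ c ∷ d ∷ D₁ ∷ D₂ ∷ []) ⟩
        a * ((c + d) * D₁ + b * D₂) - b * (a * D₂ - c * D₁)        ≡⟨ cong₂ (λ u v → a * u - b * v) ψ₀ ψ₁ ⟩
        a * ((a * (c + d) + b * c) * I) - b * ((a * (c + d) + b * c) * J) ≡⟨ solve (a ∷ b ∷ c ∷ d ∷ I ∷ J ∷ []) ⟩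
        (a * (c + d) + b * c) * (I * a - J * b)                    ∎)
    , ℤ.*-cancelˡ-≡ (a * (c + d) + b * c) D₂ (I * c + J * (c + d)) (begin
        (a * (c + d) + b * c) * D₂                                 ≡⟨ solve (a ∷ b ∷ c ∷ d ∷ D₁ ∷ D₂ ∷ []) ⟩
        c * ((c + d) * D₁ + b * D₂) + (c + d) * (a * D₂ - c * D₁)  ≡⟨ cong₂ (λ u v → c * u + (c + d) * v) ψ₀ ψ₁ ⟩
        c * ((a * (c + d) + b * c) * I) + (c + d) * ((a * (c + d) + b * c) * J) ≡⟨ solve (a ∷ b ∷ c ∷ d ∷ I ∷ J ∷ []) ⟩
        (a * (c + d) + b * c) * (I * c + J * (c + d))              ∎)
    where open ≡-Reasoning

  -- Used with h = gcd (a , c), a′ = a / h, c′ = c / h and a Bézout pair (α , γ) of a′ and c′.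
  module Smith (a′ c′ h b d α γ : ℤ) (α-γ : α * a′ + γ * c′ ≡ 1ℤ) where

    a c M L′ k₀ : ℤ
    a  = a′ * h
    c  = c′ * h
    M  = a * (c + d) + b * c
    L′ = b * c′ + (c + d) * a′
    k₀ = b * α - (c + d) * γ

    M≡hL′ : M ≡ h * L′
    M≡hL′ = begin
      a′ * h * (c′ * h + d) + b * (c′ * h)   ≡⟨ solve (a′ ∷ c′ ∷ h ∷ b ∷ d ∷ []) ⟩
      h * (b * c′ + (c′ * h + d) * a′)       ∎
      where open ≡-Reasoning

    b-combination : a′ * k₀ + γ * L′ ≡ b
    b-combination = begin
      a′ * (b * α - (c′ * h + d) * γ) + γ * (b * c′ + (c′ * h + d) * a′)  ≡⟨ solve (a′ ∷ c′ ∷ h ∷ b ∷ d ∷ α ∷ γ ∷ []) ⟩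
      b * (α * a′ + γ * c′)                                               ≡⟨ cong (b *_) α-γ ⟩
      b * 1ℤ                                                              ≡⟨ ℤ.*-identityʳ b ⟩
      b                                                                   ∎
      where open ≡-Reasoning

    c+d-combination : α * L′ - c′ * k₀ ≡ c + d
    c+d-combination = begin
      α * (b * c′ + (c′ * h + d) * a′) - c′ * (b * α - (c′ * h + d) * γ)  ≡⟨ solve (a′ ∷ c′ ∷ h ∷ b ∷ d ∷ α ∷ γ ∷ []) ⟩
      (c′ * h + d) * (α * a′ + γ * c′)                                    ≡⟨ cong ((c + d) *_) α-γ ⟩
      (c + d) * 1ℤ                                                        ≡⟨ ℤ.*-identityʳ (c + d) ⟩
      c + d                                                               ∎
      where open ≡-Reasoning

    -- P is the first adjugate column shifted by σ times the second, so it satisfies both relations for every σ;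
    -- the construction picks σ with t coprime to L′.
    module Shift (σ : ℤ) where

      t P₁ P₂ : ℤ
      t  = k₀ + h * σ
      P₁ = c + d - c * σ
      P₂ = b + a * σ

      R₁ : a * P₁ + c * P₂ ≡ M
      R₁ = begin
        a′ * h * (c′ * h + d - c′ * h * σ) + c′ * h * (b + a′ * h * σ)   ≡⟨ solve (a′ ∷ c′ ∷ h ∷ b ∷ d ∷ σ ∷ []) ⟩
        a′ * h * (c′ * h + d) + b * (c′ * h)                             ∎
        where open ≡-Reasoning

      R₂ : (a + b) * P₁ ≡ d * P₂ + (1ℤ - σ) * M
      R₂ = begin
        (a′ * h + b) * (c′ * h + d - c′ * h * σ)                                   ≡⟨ solve (a′ ∷ c′ ∷ h ∷ b ∷ d ∷ σ ∷ []) ⟩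
        d * (b + a′ * h * σ) + (1ℤ - σ) * (a′ * h * (c′ * h + d) + b * (c′ * h))   ∎
        where open ≡-Reasoning

      L′-combination : a′ * P₁ + c′ * P₂ ≡ L′
      L′-combination = begin
        a′ * (c′ * h + d - c′ * h * σ) + c′ * (b + a′ * h * σ)   ≡⟨ solve (a′ ∷ c′ ∷ h ∷ b ∷ d ∷ σ ∷ []) ⟩
        b * c′ + (c′ * h + d) * a′                               ∎
        where open ≡-Reasoning

      t-combination : α * P₂ - γ * P₁ ≡ t
      t-combination = begin
        α * (b + a′ * h * σ) - γ * (c′ * h + d - c′ * h * σ)     ≡⟨ solve (a′ ∷ c′ ∷ h ∷ b ∷ d ∷ α ∷ γ ∷ σ ∷ []) ⟩
        b * α - (c′ * h + d) * γ + h * σ * (α * a′ + γ * c′)       ≡⟨ cong (λ u → k₀ + h * σ * u) α-γ ⟩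
        k₀ + h * σ * 1ℤ                                          ≡⟨ cong (λ u → k₀ + u) (ℤ.*-identityʳ (h * σ)) ⟩
        t                                                        ∎
        where open ≡-Reasoning

      module Generator (X Y : ℤ) (X-Y : X * L′ + Y * t ≡ 1ℤ) where

        u₁ u₂ : ℤ
        u₁ = X * a′ - Y * γ
        u₂ = X * c′ + Y * α

        generator : u₁ * P₁ + u₂ * P₂ ≡ 1ℤ
        generator = begin
          u₁ * P₁ + u₂ * P₂                               ≡⟨ regroup P₁ P₂ ⟩
          X * (a′ * P₁ + c′ * P₂) + Y * (α * P₂ - γ * P₁) ≡⟨ cong₂ (λ u v → X * u + Y * v) L′-combination t-combination ⟩
          X * L′ + Y * t                                  ≡⟨ X-Y ⟩
          1ℤ                                              ∎
          where
          open ≡-Reasoning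
          regroup : ∀ p₁ p₂ → (X * a′ - Y * γ) * p₁ + (X * c′ + Y * α) * p₂ ≡ X * (a′ * p₁ + c′ * p₂) + Y * (α * p₂ - γ * p₁)
          regroup p₁ p₂ = solve (X ∷ Y ∷ a′ ∷ c′ ∷ α ∷ γ ∷ p₁ ∷ p₂ ∷ [])

        -- In the coordinates y = (α D₁ + γ D₂ , a′ D₂ - c′ D₁) the form D ↦ D₁ P₁ + D₂ P₂ reads L′ y₁ + t y₂,
        -- and t is invertible modulo L′.
        kernel : ∀ D₁ D₂ q .{{_ : NonZero M}} → D₁ * P₁ + D₂ * P₂ ≡ M * q →
                 ∃₂ λ I J → D₁ ≡ I * a - J * b × D₂ ≡ I * c + J * (c + d)
        kernel D₁ D₂ q D≡Mq = q - σ * j , j , adjugate a b c d D₁ D₂ (q - σ * j) j ψ₀ ψ₁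
          where
          open ≡-Reasoning
          change-coordinates : ∀ p₁ p₂ → (a′ * p₁ + c′ * p₂) * (α * D₁ + γ * D₂) + (α * p₂ - γ * p₁) * (a′ * D₂ - c′ * D₁)
                                         ≡ (α * a′ + γ * c′) * (D₁ * p₁ + D₂ * p₂)
          change-coordinates p₁ p₂ = solve (a′ ∷ c′ ∷ α ∷ γ ∷ D₁ ∷ D₂ ∷ p₁ ∷ p₂ ∷ [])
          expand : ∀ l s z₁ z₂ → (X * l + Y * s) * z₂ ≡ l * (X * z₂) + Y * (l * z₁ + s * z₂) - Y * l * z₁
          expand l s z₁ z₂ = solve (X ∷ Y ∷ l ∷ s ∷ z₁ ∷ z₂ ∷ [])
          factor : ∀ l z₁ z₂ → l * (X * z₂) + Y * (h * l * q) - Y * l * z₁ ≡ l * (X * z₂ + Y * (q * h - z₁))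
          factor l z₁ z₂ = solve (X ∷ Y ∷ h ∷ q ∷ l ∷ z₁ ∷ z₂ ∷ [])
          factor-M : ∀ m r → m * q - σ * (m * r) ≡ m * (q - σ * r)
          factor-M m r = solve (m ∷ q ∷ σ ∷ r ∷ [])
          y₁ y₂ j : ℤ
          y₁ = α * D₁ + γ * D₂
          y₂ = a′ * D₂ - c′ * D₁
          j  = X * y₂ + Y * (q * h - y₁)
          ψ : L′ * y₁ + t * y₂ ≡ h * L′ * q
          ψ = begin
            L′ * y₁ + t * y₂                                  ≡⟨ cong₂ (λ u v → u * y₁ + v * y₂) L′-combination t-combination ⟨
            (a′ * P₁ + c′ * P₂) * y₁ + (α * P₂ - γ * P₁) * y₂ ≡⟨ change-coordinates P₁ P₂ ⟩
            (α * a′ + γ * c′) * (D₁ * P₁ + D₂ * P₂)           ≡⟨ cong₂ _*_ α-γ D≡Mq ⟩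
            1ℤ * (M * q)                                      ≡⟨ ℤ.*-identityˡ (M * q) ⟩
            M * q                                             ≡⟨ cong (_* q) M≡hL′ ⟩
            h * L′ * q                                        ∎
          y₂≡L′j : y₂ ≡ L′ * j
          y₂≡L′j = begin
            y₂                                                ≡⟨ ℤ.*-identityˡ y₂ ⟨
            1ℤ * y₂                                           ≡⟨ cong (_* y₂) X-Y ⟨
            (X * L′ + Y * t) * y₂                             ≡⟨ expand L′ t y₁ y₂ ⟩
            L′ * (X * y₂) + Y * (L′ * y₁ + t * y₂) - Y * L′ * y₁ ≡⟨ cong (λ u → L′ * (X * y₂) + Y * u - Y * L′ * y₁) ψ ⟩
            L′ * (X * y₂) + Y * (h * L′ * q) - Y * L′ * y₁    ≡⟨ factor L′ y₁ y₂ ⟩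
            L′ * j                                            ∎
          ψ₁ : a * D₂ - c * D₁ ≡ M * j
          ψ₁ = begin
            a′ * h * D₂ - c′ * h * D₁                         ≡⟨ solve (a′ ∷ c′ ∷ h ∷ D₁ ∷ D₂ ∷ []) ⟩
            h * (a′ * D₂ - c′ * D₁)                                            ≡⟨ cong (h *_) y₂≡L′j ⟩
            h * (L′ * j)                                      ≡⟨ ℤ.*-assoc h L′ j ⟨
            h * L′ * j                                        ≡⟨ cong (_* j) M≡hL′ ⟨
            M * j                                             ∎
          ψ₀ : (c + d) * D₁ + b * D₂ ≡ M * (q - σ * j)
          ψ₀ = begin
            (c′ * h + d) * D₁ + b * D₂
              ≡⟨ solve (a′ ∷ c′ ∷ h ∷ b ∷ d ∷ σ ∷ D₁ ∷ D₂ ∷ []) ⟩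
            (D₁ * (c′ * h + d - c′ * h * σ) + D₂ * (b + a′ * h * σ)) - σ * (a′ * h * D₂ - c′ * h * D₁)
              ≡⟨ cong₂ (λ u v → u - σ * v) D≡Mq ψ₁ ⟩
            M * q - σ * (M * j)                               ≡⟨ factor-M M j ⟩
            M * (q - σ * j)                                   ∎

open SmithForm

module Tiling (a b c d : ℕ) (a>0 : a > 0) (b>0 : b > 0) (c>0 : c > 0) (d>0 : d > 0) where
  open import Data.Nat as ℕ using (ℕ; suc; _>_; _≤_)
  import Data.Nat.Properties as ℕ
  open import Data.Integer using (+_; -[1+_]; _+_; _-_; _*_; -_)
  import Data.Integer.Properties as ℤ
  open import Data.Integer.Tactic.RingSolver using (solve)
  open import Data.List using ([]; _∷_)
  open import Data.Product using (_,_)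
  open import Data.Sum using ([_,_]′)
  open import Data.Empty using (⊥-elim)
  open import Relation.Nullary using (¬_)
  open import Relation.Binary.PropositionalEquality

  open Shape a b c d a>0 b>0 c>0 d>0

  private
    swap-− : ∀ x y I J A B → x - y ≡ I * A - J * B → y - x ≡ (- I) * A - (- J) * B
    swap-− x y I J A B e = begin
      y - x                  ≡⟨ solve (x ∷ y ∷ []) ⟩
      - (x - y)              ≡⟨ cong -_ e ⟩
      - (I * A - J * B)      ≡⟨ solve (I ∷ J ∷ A ∷ B ∷ []) ⟩
      (- I) * A - (- J) * B  ∎
      where open ≡-Reasoning

    swap-+ : ∀ x y I J A B → x - y ≡ I * A + J * B → y - x ≡ (- I) * A + (- J) * B
    swap-+ x y I J A B e = begin
      y - x                  ≡⟨ solve (x ∷ y ∷ []) ⟩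
      - (x - y)              ≡⟨ cong -_ e ⟩
      - (I * A + J * B)      ≡⟨ solve (I ∷ J ∷ A ∷ B ∷ []) ⟩
      (- I) * A + (- J) * B  ∎
      where open ≡-Reasoning

    pos-lin : ∀ i A j B → + i * + A + + j * + B ≡ + (i ℕ.* A ℕ.+ j ℕ.* B)
    pos-lin i A j B = sym (trans (ℤ.pos-+ (i ℕ.* A) (j ℕ.* B)) (cong₂ _+_ (ℤ.pos-* i A) (ℤ.pos-* j B)))

    above-c+d : ∀ {y₁ y₂ y₂′} i j → + y₂ - + y₂′ ≡ + i * + c + + suc j * (+ c + + d) → ¬ L (y₁ , y₂)
    above-c+d {y₁} {y₂} {y₂′} i j e y∈L = ℕ.<⇒≱ (L⇒<c+d y∈L) (begin
      c ℕ.+ d                                      ≤⟨ ℕ.m≤m+n (c ℕ.+ d) (j ℕ.* (c ℕ.+ d)) ⟩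
      suc j ℕ.* (c ℕ.+ d)                          ≤⟨ ℕ.m≤n+m _ (y₂′ ℕ.+ i ℕ.* c) ⟩
      y₂′ ℕ.+ i ℕ.* c ℕ.+ suc j ℕ.* (c ℕ.+ d)      ≡⟨ ℕ.+-assoc y₂′ (i ℕ.* c) _ ⟩
      y₂′ ℕ.+ (i ℕ.* c ℕ.+ suc j ℕ.* (c ℕ.+ d))    ≡⟨ pos-difference {y₂} {y₂′} (trans e (trans (cong (λ u → + i * + c + + suc j * u)
                                                         (sym (ℤ.pos-+ c d))) (pos-lin i c (suc j) (c ℕ.+ d)))) ⟨
      y₂                                           ∎)
      where open ℕ.≤-Reasoning

    right-of-a+b : ∀ {y₁ y₁′ y₂′} i j → + y₁ - + y₁′ ≡ -[1+ i ] * + a - + suc j * + b → ¬ L (y₁′ , y₂′)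
    right-of-a+b {y₁} {y₁′} i j e y′∈L = ℕ.<⇒≱ (L⇒<a+b y′∈L) (begin
      a ℕ.+ b                                      ≤⟨ ℕ.+-mono-≤ (ℕ.m≤m+n a (i ℕ.* a)) (ℕ.m≤m+n b (j ℕ.* b)) ⟩
      suc i ℕ.* a ℕ.+ suc j ℕ.* b                  ≤⟨ ℕ.m≤n+m _ y₁ ⟩
      y₁ ℕ.+ (suc i ℕ.* a ℕ.+ suc j ℕ.* b)         ≡⟨ neg-difference {y₁} {y₁′} (trans e (trans (negate (+ suc i) (+ a) (+ suc j) (+ b))
                                                         (cong -_ (pos-lin (suc i) a (suc j) b)))) ⟨
      y₁′                                          ∎)
      where
      open ℕ.≤-Reasoning
      negate : ∀ I A J B → (- I) * A - J * B ≡ - (I * A + J * B)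
      negate I A J B = solve (I ∷ A ∷ J ∷ B ∷ [])

    above-corner : ∀ {y₁ y₂ y₁′ y₂′} i → + y₁ - + y₁′ ≡ + suc i * + a - + 0 * + b →
                   + y₂ - + y₂′ ≡ + suc i * + c + + 0 * (+ c + + d) → ¬ L (y₁ , y₂)
    above-corner {y₁} {y₂} {y₁′} {y₂′} i e₁ e₂ =
      [ (λ (_ , y₂<c) → ℕ.<⇒≱ y₂<c c≤y₂) , (λ (y₁<a , _) → ℕ.<⇒≱ y₁<a a≤y₁) ]′
      where
      drop-− : ∀ u v → u - + 0 * v ≡ u
      drop-− u v = solve (u ∷ v ∷ [])
      drop-+ : ∀ u v → u + + 0 * v ≡ u
      drop-+ u v = solve (u ∷ v ∷ [])
      a≤y₁ : a ≤ y₁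
      a≤y₁ = subst (a ≤_) (sym (pos-difference {y₁} {y₁′} (trans e₁ (trans (drop-− _ (+ b)) (sym (ℤ.pos-* (suc i) a))))))
                   (ℕ.≤-trans (ℕ.m≤m+n a (i ℕ.* a)) (ℕ.m≤n+m _ y₁′))
      c≤y₂ : c ≤ y₂
      c≤y₂ = subst (c ≤_) (sym (pos-difference {y₂} {y₂′} (trans e₂ (trans (drop-+ _ (+ c + + d)) (sym (ℤ.pos-* (suc i) c))))))
                   (ℕ.≤-trans (ℕ.m≤m+n c (i ℕ.* c)) (ℕ.m≤n+m _ y₂′))

  tile : ∀ {y₁ y₂ y₁′ y₂′} → L (y₁ , y₂) → L (y₁′ , y₂′) → ∀ I J →
         + y₁ - + y₁′ ≡ I * + a - J * + b → + y₂ - + y₂′ ≡ I * + c + J * (+ c + + d) → (y₁ , y₂) ≡ (y₁′ , y₂′)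
  tile {y₁} {y₂} {y₁′} {y₂′} y∈L y′∈L (+ 0) (+ 0) e₁ e₂ =
    cong₂ _,_ (trans (pos-difference {y₁} {y₁′} e₁) (ℕ.+-identityʳ y₁′)) (trans (pos-difference {y₂} {y₂′} e₂) (ℕ.+-identityʳ y₂′))
  tile {y₁} {y₂} {y₁′} {y₂′} y∈L y′∈L (+ i) (+ suc j) e₁ e₂ =
    ⊥-elim (above-c+d {y₁} {y₂} {y₂′} i j e₂ y∈L)
  tile {y₁} {y₂} {y₁′} {y₂′} y∈L y′∈L -[1+ i ] (+ suc j) e₁ e₂ =
    ⊥-elim (right-of-a+b {y₁} {y₁′} {y₂′} i j e₁ y′∈L)
  tile {y₁} {y₂} {y₁′} {y₂′} y∈L y′∈L (+ suc i) (+ 0) e₁ e₂ =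
    ⊥-elim (above-corner {y₁} {y₂} {y₁′} {y₂′} i e₁ e₂ y∈L)
  tile {y₁} {y₂} {y₁′} {y₂′} y∈L y′∈L -[1+ i ] (+ 0) e₁ e₂ =
    ⊥-elim (above-corner {y₁′} {y₂′} {y₁} {y₂} i (swap-− (+ y₁) (+ y₁′) -[1+ i ] (+ 0) (+ a) (+ b) e₁)
                                                 (swap-+ (+ y₂) (+ y₂′) -[1+ i ] (+ 0) (+ c) (+ c + + d) e₂) y′∈L)
  tile {y₁} {y₂} {y₁′} {y₂′} y∈L y′∈L (+ 0) -[1+ j ] e₁ e₂ =
    ⊥-elim (above-c+d {y₁′} {y₂′} {y₂} 0 j (swap-+ (+ y₂) (+ y₂′) (+ 0) -[1+ j ] (+ c) (+ c + + d) e₂) y′∈L)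
  tile {y₁} {y₂} {y₁′} {y₂′} y∈L y′∈L (+ suc i) -[1+ j ] e₁ e₂ =
    ⊥-elim (right-of-a+b {y₁′} {y₁} {y₂} i j (swap-− (+ y₁) (+ y₁′) (+ suc i) -[1+ j ] (+ a) (+ b) e₁) y∈L)
  tile {y₁} {y₂} {y₁′} {y₂′} y∈L y′∈L -[1+ i ] -[1+ j ] e₁ e₂ =
    ⊥-elim (above-c+d {y₁′} {y₂′} {y₂} (suc i) j (swap-+ (+ y₂) (+ y₂′) -[1+ i ] -[1+ j ] (+ c) (+ c + + d) e₂) y′∈L)

module Construction (a b c d : ℕ) (a>0 : a > 0) (b>0 : b > 0) (c>0 : c > 0) (d>0 : d > 0)
                    (gcd≡1 : gcd (gcd a b) (gcd c d) ≡ 1) where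
  open import Data.Nat as ℕ using (ℕ; suc; _>_; pred; NonZero; ≢-nonZero)
  import Data.Nat.Properties as ℕ
  open import Data.Nat.DivMod using (_/_; m/n*n≡m)
  open import Data.Nat.Divisibility as ℕ∣ using (∣-trans; ∣m+n∣m⇒∣n; ∣1⇒≡1)
  open import Data.Nat.GCD using (gcd; gcd[m,n]∣m; gcd[m,n]∣n; gcd[m,n]≢0; gcd-greatest)
  open import Data.Nat.Coprimality using (Coprime; coprime-Bézout; coprime-/gcd)
  open import Data.Integer as ℤ using (ℤ; +_; _+_; _-_; _*_; -_; 0ℤ; 1ℤ)
  import Data.Integer.Properties as ℤ
  open import Data.Integer.DivMod using (_%ℕ_; _/ℕ_; a≡a%ℕn+[a/ℕn]*n)
  import Data.Integer.Divisibility.Signed as ℤ∣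
  open import Data.Integer.Tactic.RingSolver using (solve)
  open import Data.List using ([]; _∷_)
  open import Data.Product using (∃; ∃₂; _×_; _,_; proj₁; proj₂)
  open import Data.Sum using (inj₁; inj₂)
  open import Relation.Binary.PropositionalEquality

  open Shape a b c d a>0 b>0 c>0 d>0
  open Tiling a b c d a>0 b>0 c>0 d>0

  -- The number-theoretic witnesses are opaque so that conversion checking never unfolds gcd or Bézout.
  opaque
    h : ℕ
    h = gcd a c

    h∣a : h ℕ∣.∣ a
    h∣a = gcd[m,n]∣m a c

    h∣c : h ℕ∣.∣ c
    h∣c = gcd[m,n]∣n a c

    instance
      h-nonZero : NonZero h
      h-nonZero = ≢-nonZero (gcd[m,n]≢0 a c (inj₁ (≢-sym (ℕ.<⇒≢ a>0))))

    a′ c′ : ℕ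
    a′ = a / h
    c′ = c / h

    a≡a′h : a ≡ a′ ℕ.* h
    a≡a′h = sym (m/n*n≡m h∣a)

    c≡c′h : c ≡ c′ ℕ.* h
    c≡c′h = sym (m/n*n≡m h∣c)

    bézout-a′c′ : ∃₂ λ α γ → α * + a′ + γ * + c′ ≡ 1ℤ
    bézout-a′c′ = bézout (coprime-Bézout (coprime-/gcd a c))

  α γ : ℤ
  α = proj₁ bézout-a′c′
  γ = proj₁ (proj₂ bézout-a′c′)

  module S = Smith (+ a′) (+ c′) (+ h) (+ b) (+ d) α γ (proj₂ (proj₂ bézout-a′c′))

  a≈ : + a ≡ S.a
  a≈ = trans (cong +_ a≡a′h) (ℤ.pos-* a′ h)

  c≈ : + c ≡ S.c
  c≈ = trans (cong +_ c≡c′h) (ℤ.pos-* c′ h)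

  c+d≈ : + (c ℕ.+ d) ≡ S.c + + d
  c+d≈ = trans (ℤ.pos-+ c d) (cong (_+ + d) c≈)

  L′ℕ : ℕ
  L′ℕ = b ℕ.* c′ ℕ.+ (c ℕ.+ d) ℕ.* a′

  L′≈ : + L′ℕ ≡ S.L′
  L′≈ = begin
    + (b ℕ.* c′ ℕ.+ (c ℕ.+ d) ℕ.* a′)          ≡⟨ ℤ.pos-+ (b ℕ.* c′) _ ⟩
    + (b ℕ.* c′) + + ((c ℕ.+ d) ℕ.* a′)         ≡⟨ cong₂ _+_ (ℤ.pos-* b c′) (ℤ.pos-* (c ℕ.+ d) a′) ⟩
    + b * + c′ + + (c ℕ.+ d) * + a′             ≡⟨ cong (λ u → + b * + c′ + u * + a′) c+d≈ ⟩
    S.L′                                         ∎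
    where open ≡-Reasoning

  Mℕ : ℕ
  Mℕ = a ℕ.* (c ℕ.+ d) ℕ.+ b ℕ.* c

  M≈ : + Mℕ ≡ S.M
  M≈ = begin
    + (a ℕ.* (c ℕ.+ d) ℕ.+ b ℕ.* c)             ≡⟨ ℤ.pos-+ (a ℕ.* (c ℕ.+ d)) _ ⟩
    + (a ℕ.* (c ℕ.+ d)) + + (b ℕ.* c)           ≡⟨ cong₂ _+_ (ℤ.pos-* a (c ℕ.+ d)) (ℤ.pos-* b c) ⟩
    + a * + (c ℕ.+ d) + + b * + c               ≡⟨ cong₂ (λ u v → u * v + + b * + c) a≈ c+d≈ ⟩
    S.a * (S.c + + d) + + b * + c               ≡⟨ cong (λ u → S.a * (S.c + + d) + + b * u) c≈ ⟩
    S.M                                          ∎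
    where open ≡-Reasoning

  A : ℕ
  A = S.k₀ %ℕ h

  q₀ : ℤ
  q₀ = S.k₀ /ℕ h

  k₀≡ : S.k₀ ≡ + A + q₀ * + h
  k₀≡ = a≡a%ℕn+[a/ℕn]*n S.k₀ h

  -- gcd (a , b , c , d) = 1 is exactly what rules out a common factor of A, h and L′.
  no-common-factor : ∀ {e} → e ℕ∣.∣ A → e ℕ∣.∣ h → e ℕ∣.∣ L′ℕ → e ≡ 1
  no-common-factor {e} e∣A e∣h e∣L′ℕ =
    ∣1⇒≡1 (subst (e ℕ∣.∣_) gcd≡1 (gcd-greatest (gcd-greatest e∣a e∣b) (gcd-greatest e∣c e∣d)))
    where
    e∣a = ∣-trans e∣h h∣a
    e∣c = ∣-trans e∣h h∣c
    e∣k₀ : + e ℤ∣.∣ S.k₀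
    e∣k₀ = subst (+ e ℤ∣.∣_) (sym k₀≡)
             (ℤ∣.∣m∣n⇒∣m+n (ℤ∣.∣ᵤ⇒∣ {+ e} {+ A} e∣A) (ℤ∣.∣n⇒∣m*n q₀ (ℤ∣.∣ᵤ⇒∣ {+ e} {+ h} e∣h)))
    e∣L′ : + e ℤ∣.∣ S.L′
    e∣L′ = subst (+ e ℤ∣.∣_) L′≈ (ℤ∣.∣ᵤ⇒∣ {+ e} {+ L′ℕ} e∣L′ℕ)
    e∣b : e ℕ∣.∣ b
    e∣b = ℤ∣.∣⇒∣ᵤ {+ e} {+ b} (subst (+ e ℤ∣.∣_) S.b-combination
                                 (ℤ∣.∣m∣n⇒∣m+n (ℤ∣.∣n⇒∣m*n (+ a′) e∣k₀) (ℤ∣.∣n⇒∣m*n γ e∣L′)))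
    e∣c+d : e ℕ∣.∣ c ℕ.+ d
    e∣c+d = ℤ∣.∣⇒∣ᵤ {+ e} {+ (c ℕ.+ d)} (subst (+ e ℤ∣.∣_) (trans S.c+d-combination (sym c+d≈))
                                           (ℤ∣.∣m∣n⇒∣m-n (ℤ∣.∣n⇒∣m*n α e∣L′) (ℤ∣.∣n⇒∣m*n (+ c′) e∣k₀)))
    e∣d = ∣m+n∣m⇒∣n e∣c+d e∣c

  L′ℕ≢0 : L′ℕ ≢ 0
  L′ℕ≢0 L′≡0 with ℕ.m*n≡0⇒m≡0∨n≡0 (c ℕ.+ d) (ℕ.m+n≡0⇒n≡0 (b ℕ.* c′) L′≡0)
  ... | inj₁ c+d≡0 = ℕ.<⇒≢ (c+d>0) (sym c+d≡0)
  ... | inj₂ a′≡0  = ℕ.<⇒≢ a>0 (sym (trans a≡a′h (cong (ℕ._* h) a′≡0)))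

  opaque
    shift : ∃ λ s → Coprime (A ℕ.+ s ℕ.* h) L′ℕ
    shift = coprime-shift A h L′ℕ L′ℕ≢0 no-common-factor

  s tℕ : ℕ
  s  = proj₁ shift
  tℕ = A ℕ.+ s ℕ.* h

  σ : ℤ
  σ = + s - q₀

  module T = S.Shift σ

  t≈ : + tℕ ≡ T.t
  t≈ = begin
    + (A ℕ.+ s ℕ.* h)                    ≡⟨ trans (ℤ.pos-+ A (s ℕ.* h)) (cong (λ u → + A + u) (ℤ.pos-* s h)) ⟩
    + A + + s * + h                      ≡⟨ regroup (+ A) (+ s) (+ h) q₀ ⟩
    (+ A + q₀ * + h) + + h * (+ s - q₀)  ≡⟨ cong (_+ + h * σ) k₀≡ ⟨
    T.t                                  ∎
    where
    open ≡-Reasoning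
    regroup : ∀ r s h q → r + s * h ≡ (r + q * h) + h * (s - q)
    regroup r s h q = solve (r ∷ s ∷ h ∷ q ∷ [])

  opaque
    bézout-tL′ : ∃₂ λ x y → x * + tℕ + y * + L′ℕ ≡ 1ℤ
    bézout-tL′ = bézout (coprime-Bézout (proj₂ shift))

  X Y : ℤ
  X = proj₁ (proj₂ bézout-tL′)
  Y = proj₁ bézout-tL′

  X-Y : X * S.L′ + Y * T.t ≡ 1ℤ
  X-Y = begin
    X * S.L′ + Y * T.t          ≡⟨ cong₂ (λ u v → X * u + Y * v) L′≈ t≈ ⟨
    X * + L′ℕ + Y * + tℕ        ≡⟨ ℤ.+-comm (X * + L′ℕ) (Y * + tℕ) ⟩
    Y * + tℕ + X * + L′ℕ        ≡⟨ proj₂ (proj₂ bézout-tL′) ⟩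
    1ℤ                          ∎
    where open ≡-Reasoning

  module G = T.Generator X Y X-Y

  instance
    Mℕ-nonZero : NonZero Mℕ
    Mℕ-nonZero = ℕ.>-nonZero (ℕ.≤-trans (ℕ.*-mono-≤ a>0 c+d>0) (ℕ.m≤m+n (a ℕ.* (c ℕ.+ d)) (b ℕ.* c)))

  k : ℕ
  k = pred Mℕ

  m≈ : + suc k ≡ S.M
  m≈ = trans (cong +_ (ℕ.suc-pred Mℕ)) M≈

  P₁ P₂ u₁ u₂ : ℕ
  P₁ = T.P₁ %ℕ suc k
  P₂ = T.P₂ %ℕ suc k
  u₁ = G.u₁ %ℕ suc k
  u₂ = G.u₂ %ℕ suc k

  M-nonZero : ℤ.NonZero S.M
  M-nonZero = subst ℤ.NonZero m≈ _

  M≡0 : S.M ≡ 0ℤ [modℤ suc k ]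
  M≡0 = modℤ-trans (modℤ-reflexive (sym m≈)) n≡0-modℤ

  R₁ : (a , c) ∙ (P₁ , P₂) ≡ 0 [mod suc k ]
  R₁ = modℤ⇒mod (begin
    + ((a , c) ∙ (P₁ , P₂))         ≈⟨ ∙-%ℕ a c T.P₁ T.P₂ ⟩
    + a * T.P₁ + + c * T.P₂         ≡⟨ cong₂ (λ u v → u * T.P₁ + v * T.P₂) a≈ c≈ ⟩
    S.a * T.P₁ + S.c * T.P₂         ≡⟨ T.R₁ ⟩
    S.M                             ≈⟨ M≡0 ⟩
    0ℤ                              ∎)
    where open ≡-modℤ-Reasoning (suc k)

  R₂ : (a ℕ.+ b , 0) ∙ (P₁ , P₂) ≡ (0 , d) ∙ (P₁ , P₂) [mod suc k ]
  R₂ = modℤ⇒mod (begin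
    + ((a ℕ.+ b , 0) ∙ (P₁ , P₂))             ≈⟨ ∙-%ℕ (a ℕ.+ b) 0 T.P₁ T.P₂ ⟩
    + (a ℕ.+ b) * T.P₁ + + 0 * T.P₂           ≡⟨ drop (+ (a ℕ.+ b) * T.P₁) T.P₂ ⟩
    + (a ℕ.+ b) * T.P₁                        ≡⟨ cong (_* T.P₁) (trans (ℤ.pos-+ a b) (cong (_+ + b) a≈)) ⟩
    (S.a + + b) * T.P₁                        ≡⟨ T.R₂ ⟩
    + d * T.P₂ + (1ℤ - σ) * S.M               ≈⟨ +-cong-modℤ (modℤ-refl {x = + d * T.P₂})
                                                             (*-cong-modℤ (modℤ-refl {x = 1ℤ - σ}) M≡0) ⟩
    + d * T.P₂ + (1ℤ - σ) * 0ℤ                ≡⟨ vanish (+ d * T.P₂) (1ℤ - σ) T.P₁ ⟩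
    + 0 * T.P₁ + + d * T.P₂                   ≈⟨ ∙-%ℕ 0 d T.P₁ T.P₂ ⟨
    + ((0 , d) ∙ (P₁ , P₂))                   ∎)
    where
    open ≡-modℤ-Reasoning (suc k)
    drop : ∀ u v → u + + 0 * v ≡ u
    drop u v = solve (u ∷ v ∷ [])
    vanish : ∀ u w v → u + w * 0ℤ ≡ + 0 * v + u
    vanish u w v = solve (u ∷ w ∷ v ∷ [])

  generator : (u₁ , u₂) ∙ (P₁ , P₂) ≡ 1 [mod suc k ]
  generator = modℤ⇒mod (begin
    + ((u₁ , u₂) ∙ (P₁ , P₂))                 ≡⟨ pos-∙ u₁ u₂ P₁ P₂ ⟩
    + u₁ * + P₁ + + u₂ * + P₂                 ≈⟨ +-cong-modℤ (*-cong-modℤ (%ℕ-modℤ G.u₁) (%ℕ-modℤ T.P₁))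
                                                             (*-cong-modℤ (%ℕ-modℤ G.u₂) (%ℕ-modℤ T.P₂)) ⟩
    G.u₁ * T.P₁ + G.u₂ * T.P₂                 ≡⟨ G.generator ⟩
    1ℤ                                        ∎)
    where open ≡-modℤ-Reasoning (suc k)

  ψ-congruence : ∀ {y₁ y₂ y₁′ y₂′} → (y₁ , y₂) ∙ (P₁ , P₂) ≡ (y₁′ , y₂′) ∙ (P₁ , P₂) [mod suc k ] →
                 + y₁ * T.P₁ + + y₂ * T.P₂ ≡ + y₁′ * T.P₁ + + y₂′ * T.P₂ [modℤ suc k ]
  ψ-congruence {y₁} {y₂} {y₁′} {y₂′} e =
    modℤ-trans (modℤ-sym (∙-%ℕ y₁ y₂ T.P₁ T.P₂)) (modℤ-trans (mod⇒modℤ e) (∙-%ℕ y₁′ y₂′ T.P₁ T.P₂))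

  Λ-difference : ∀ {y₁ y₂ y₁′ y₂′} → + y₁ * T.P₁ + + y₂ * T.P₂ ≡ + y₁′ * T.P₁ + + y₂′ * T.P₂ [modℤ suc k ] →
                 ∃₂ λ I J → + y₁ - + y₁′ ≡ I * S.a - J * + b × + y₂ - + y₂′ ≡ I * S.c + J * (S.c + + d)
  Λ-difference {y₁} {y₂} {y₁′} {y₂′} (modℤ (ℤ∣.divides q ψ≡)) =
    G.kernel (+ y₁ - + y₁′) (+ y₂ - + y₂′) q {{M-nonZero}} D≡Mq
    where
    D≡Mq : (+ y₁ - + y₁′) * T.P₁ + (+ y₂ - + y₂′) * T.P₂ ≡ S.M * q
    D≡Mq = begin
      (+ y₁ - + y₁′) * T.P₁ + (+ y₂ - + y₂′) * T.P₂                 ≡⟨ regroup (+ y₁) (+ y₁′) (+ y₂) (+ y₂′) T.P₁ T.P₂ ⟩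
      (+ y₁ * T.P₁ + + y₂ * T.P₂) - (+ y₁′ * T.P₁ + + y₂′ * T.P₂)   ≡⟨ ψ≡ ⟩
      q * + suc k                                                   ≡⟨ cong (q *_) m≈ ⟩
      q * S.M                                                       ≡⟨ ℤ.*-comm q S.M ⟩
      S.M * q                                                       ∎
      where
      open ≡-Reasoning
      regroup : ∀ x x′ y y′ p₁ p₂ → (x - x′) * p₁ + (y - y′) * p₂ ≡ (x * p₁ + y * p₂) - (x′ * p₁ + y′ * p₂)
      regroup x x′ y y′ p₁ p₂ = solve (x ∷ x′ ∷ y ∷ y′ ∷ p₁ ∷ p₂ ∷ [])

  ∙-injective : ∀ {y y′} → L y → L y′ → y ∙ (P₁ , P₂) ≡ y′ ∙ (P₁ , P₂) [mod suc k ] → y ≡ y′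
  ∙-injective {y₁ , y₂} {y₁′ , y₂′} y∈L y′∈L e =
    in-Λ⇒≡ (Λ-difference {y₁} {y₂} {y₁′} {y₂′} (ψ-congruence {y₁} {y₂} {y₁′} {y₂′} e))
    where
    in-Λ⇒≡ : (∃₂ λ I J → + y₁ - + y₁′ ≡ I * S.a - J * + b × + y₂ - + y₂′ ≡ I * S.c + J * (S.c + + d)) →
             (y₁ , y₂) ≡ (y₁′ , y₂′)
    in-Λ⇒≡ (I , J , e₁ , e₂) = tile y∈L y′∈L I J (trans e₁ (cong (λ u → I * u - J * + b) (sym a≈)))
                                                   (trans e₂ (cong (λ u → I * u + J * (u + + d)) (sym c≈)))

  bijective : Bijective (suc k) P₁ P₂
  bijective = record { ∙-injective = ∙-injective ; ∙-surjective = ∙-surjective-from P₁ P₂ R₁ R₂ u₁ u₂ generator }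

theorem6p11 : (a b c d : ℕ) → 1 ≤ a → 1 ≤ b → 1 ≤ c → 1 ≤ d →
    (Σ ℕ λ m → 2 ≤ m × Σ (KunzPoint m) λ K → Nil.HasShape K a b c d)
      ⇔ (gcd (gcd a b) (gcd c d) ≡ 1)
theorem6p11 a b c d a>0 b>0 c>0 d>0 = mk⇔ shape⇒gcd gcd⇒shape
  where
  open Shape a b c d a>0 b>0 c>0 d>0 using (module Bijective; bijective⇒2≤m)

  shape⇒gcd : (Σ ℕ λ m → 2 ≤ m × Σ (KunzPoint m) λ K → Nil.HasShape K a b c d) → gcd (gcd a b) (gcd c d) ≡ 1
  shape⇒gcd (zero , () , _)
  shape⇒gcd (suc k , _ , K , p₁ , p₂ , _ , (p₁≢0 , _) , (p₂≢0 , _) , _ , staircase , betti) =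
    Bijective.gcd≡1 (Forward.bijective K a b c d a>0 b>0 c>0 d>0 p₁ p₂ p₁≢0 p₂≢0 staircase betti)

  gcd⇒shape : gcd (gcd a b) (gcd c d) ≡ 1 → Σ ℕ λ m → 2 ≤ m × Σ (KunzPoint m) λ K → Nil.HasShape K a b c d
  gcd⇒shape gcd≡1 = suc k , bijective⇒2≤m bijective , Backward.K a b c d a>0 b>0 c>0 d>0 P₁ P₂ bijective
                                                     , Backward.shape a b c d a>0 b>0 c>0 d>0 P₁ P₂ bijective
    where open Construction a b c d a>0 b>0 c>0 d>0 gcd≡1 using (k; P₁; P₂; bijective)
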